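{- For every positive integer $n$, the complete bipartite graph $K_{n,n}$ satisfies $\operatorname{sn}(K_{n,n})=\operatorname{csn}(K_{n,n})=n$.
   Context: A (straight-line) drawing of a graph maps its vertices to distinct points in the plane and represents each edge by the closed line segment between its endpoints, such that each edge segment intersects no vertex other than its own endpoints. The slope of an edge is the angle in $[0,\pi)$ from the $x$-axis to the line containing it. The slope-number $\operatorname{sn}(G)$ is the minimum number of distinct edge slopes over all drawings of $G$. A drawing is convex if all vertices lie on the boundary of the convex hull and no three vertices are collinear; the convex slope-number $\operatorname{csn}(G)$ is the minimum number of distinct edge slopes over all convex drawings of $G$. -}

module Defs where

open import Level using (0ℓ)
open import Data.Nat using (ℕ)
open import Data.Fin using (Fin)
open import Data.Product using (Σ; ∃; _×_; _,_)
open import Data.Sum using (_⊎_; inj₁; inj₂)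
open import Data.Unit using (⊤)
open import Data.Empty using (⊥)
open import Relation.Nullary using (¬_)
open import Relation.Binary.PropositionalEquality using (_≡_; _≢_)
open import Relation.Binary.Definitions using (Trichotomous)
open import Algebra.Structures using (IsCommutativeRing)

-- The real numbers, given axiomatically as a Dedekind-complete ordered
-- field (any model is isomorphic to ℝ).  The theorem is stated for every
-- such model.

record RealField : Set₁ where
  infixl 6 _+_ _-_
  infixl 7 _*_
  infix 4 _<_ _≤_
  field
    ℝ   : Set
    0r 1r : ℝ
    _+_ _*_ : ℝ → ℝ → ℝ
    -_  : ℝ → ℝ
    _<_ : ℝ → ℝ → Set
    isCommutativeRing : IsCommutativeRing {A = ℝ} _≡_ _+_ _*_ -_ 0r 1r
    0≢1     : 0r ≢ 1r
    inverse : ∀ x → x ≢ 0r → ∃ λ y → x * y ≡ 1r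
    <-trans : ∀ {x y z} → x < y → y < z → x < z
    <-cmp   : Trichotomous _≡_ _<_
    +-mono-< : ∀ {x y} z → x < y → x + z < y + z
    *-pos    : ∀ {x y} → 0r < x → 0r < y → 0r < x * y

  _-_ : ℝ → ℝ → ℝ
  x - y = x + (- y)

  _≤_ : ℝ → ℝ → Set
  x ≤ y = (x < y) ⊎ (x ≡ y)

  field
    complete : (S : ℝ → Set) → (∃ λ x → S x) → (∃ λ b → ∀ x → S x → x ≤ b) →
               ∃ λ s → (∀ x → S x → x ≤ s) × (∀ b → (∀ x → S x → x ≤ b) → s ≤ b)

record Graph : Set₁ where
  field
    V : Set
    E : V → V → Set

KBip : ℕ → ℕ → Graph
KBip n m = record { V = Fin n ⊎ Fin m ; E = adj }
  where
  adj : Fin n ⊎ Fin m → Fin n ⊎ Fin m → Set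
  adj (inj₁ _) (inj₂ _) = ⊤
  adj (inj₂ _) (inj₁ _) = ⊤
  adj (inj₁ _) (inj₁ _) = ⊥
  adj (inj₂ _) (inj₂ _) = ⊥

module Plane (R : RealField) where
  open RealField R

  Point : Set
  Point = ℝ × ℝ

  x-of y-of : Point → ℝ
  x-of (a , _) = a
  y-of (_ , b) = b

  cross : Point → Point → Point → ℝ
  cross o p q = (x-of p - x-of o) * (y-of q - y-of o) - (y-of p - y-of o) * (x-of q - x-of o)

  Collinear : Point → Point → Point → Set
  Collinear o p q = cross o p q ≡ 0r

  OnSegment : Point → Point → Point → Set
  OnSegment u v w = ∃ λ t → (0r ≤ t) × (t ≤ 1r) ×
    (x-of w ≡ x-of u + t * (x-of v - x-of u)) × (y-of w ≡ y-of u + t * (y-of v - y-of u))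

  module _ (G : Graph) where
    open Graph G

    Edge : Set
    Edge = Σ (V × V) λ { (u , v) → E u v }

    record Drawing : Set where
      field
        pos      : V → Point
        distinct : ∀ u v → u ≢ v → pos u ≢ pos v
        clear    : ∀ u v → E u v → ∀ w → w ≢ u → w ≢ v → ¬ OnSegment (pos u) (pos v) (pos w)

    module _ (D : Drawing) where
      open Drawing D

      SameSlope : Edge → Edge → Set
      SameSlope ((u , v) , _) ((u' , v') , _) =
        (x-of (pos v) - x-of (pos u)) * (y-of (pos v') - y-of (pos u'))
          ≡ (y-of (pos v) - y-of (pos u)) * (x-of (pos v') - x-of (pos u'))

      AtMostSlopes : ℕ → Set
      AtMostSlopes k = Σ (Edge → Fin k) λ f → ∀ e e' → f e ≡ f e' → SameSlope e e'

      AtLeastSlopes : ℕ → Set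
      AtLeastSlopes k = Σ (Fin k → Edge) λ g → ∀ a b → a ≢ b → ¬ SameSlope (g a) (g b)

      -- convex drawing: no three vertices collinear, and every vertex is on the
      -- boundary of the convex hull, i.e. has a supporting line through it
      Convex : Set
      Convex = (∀ u v w → u ≢ v → v ≢ w → u ≢ w → ¬ Collinear (pos u) (pos v) (pos w))
             × (∀ u → ∃ λ (d : Point) → ¬ (d ≡ (0r , 0r)) ×
                  (∀ w → 0r ≤ x-of d * (x-of (pos w) - x-of (pos u)) + y-of d * (y-of (pos w) - y-of (pos u))))

    SlopeNumberIs : ℕ → Set
    SlopeNumberIs k = (∃ λ D → AtMostSlopes D k) × (∀ D → AtLeastSlopes D k)

    ConvexSlopeNumberIs : ℕ → Set
    ConvexSlopeNumberIs k = (∃ λ D → Convex D × AtMostSlopes D k)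
                          × (∀ D → Convex D → AtLeastSlopes D k)

module Submission where

-- Upper bound: put the two colour classes alternately on the vertices of a regular 2n-gon, at the
-- even and odd powers of a primitive 2n-th root of unity ζ.  For x, y on the unit circle
-- conj (y - x) = - conj (x y) (y - x), so the direction of a chord is determined by the product of
-- its endpoints; the edge from ζ^(2i) to ζ^(2j+1) therefore has a slope determined by i + j mod n.
-- Points on a circle are in convex position.  Without trigonometry, ζ is found by a supremum
-- argument: z t = (1 + i t)² / (1 + t²) runs along the upper unit half-circle, and at the first t
-- where one of Im z, …, Im zⁿ vanishes one gets zⁿ = -1.
--
-- Lower bound: in any drawing, take the lexicographically smallest vertex v.  Two edges at v with
-- the same slope both point lexicographically upwards, so one would contain the other endpoint;
-- hence the n edges at v have n distinct slopes.

open import Defs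
open import Algebra.Bundles using (CommutativeRing; RawRing)
open import Algebra.Structures using (IsCommutativeRing)
import Algebra.Solver.Ring.AlmostCommutativeRing as ACR
open import Data.Empty using (⊥; ⊥-elim)
open import Data.Fin as Fin using (Fin; toℕ; combine; splitAt; join)
import Data.Fin.Properties as Fin
open import Data.Integer as ℤ using (ℤ; +_; -[1+_]; _⊖_)
import Data.Integer.Properties as ℤ
open import Data.Maybe using (Maybe; nothing; just)
open import Data.Nat as ℕ using (ℕ; zero; suc; z≤n; s≤s)
import Data.Nat.Properties as ℕ
open import Data.Nat.DivMod using (DivMod; _divMod_)
open import Data.Nat.Tactic.RingSolver using (solve-∀)
open import Data.Product using (∃; _×_; _,_; proj₁; proj₂)
open import Data.Product.Relation.Binary.Lex.Strict using (×-Lex; ×-transitive; ×-compare)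
open import Data.Product.Relation.Binary.Pointwise.NonDependent using (≡⇒≡×≡; ≡×≡⇒≡)
open import Data.Sum using (_⊎_; inj₁; inj₂)
open import Data.Sum.Properties using (inj₁-injective; inj₂-injective)
open import Data.Unit using (tt)
open import Function using (_∘_)
open import Level using (0ℓ)
open import Relation.Binary.Consequences using (tri⇒irr)
open import Relation.Binary.Core using (Rel)
open import Relation.Binary.Definitions using (Transitive; Trichotomous; Tri; tri<; tri≈; tri>)
open import Relation.Binary.PropositionalEquality as ≡
  using (_≡_; _≢_; refl; sym; trans; cong; cong₂; subst; subst₂; isEquivalence; resp₂; module ≡-Reasoning)
open import Relation.Nullary using (¬_; Dec; yes; no)

-- The ring solver of the standard library needs a coefficient ring with decidable
-- equality; ℤ maps homomorphically into every commutative ring.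
module IntegerCoefficients {c ℓ} (R : CommutativeRing c ℓ) where
  open CommutativeRing R renaming (refl to ≈-refl; sym to ≈-sym; trans to ≈-trans)
  open import Algebra.Properties.Ring ring using (-‿involutive; -0#≈0#; -‿distribˡ-*; -‿distribʳ-*; -‿+-comm)
  open import Algebra.Properties.Semiring.Mult.TCOptimised semiring using (1+×; ×-homo-+; ×1-homo-*)
    renaming (_×_ to _·_)
  open import Relation.Binary.Reasoning.Setoid setoid

  -- The type-checking-optimised multiple makes con (+ 1) and con (+ 2) reduce to 1# and 1# + 1#.
  ⟦_⟧ℤ : ℤ → Carrier
  ⟦ + n ⟧ℤ      = n · 1#
  ⟦ -[1+ n ] ⟧ℤ = - (suc n · 1#)

  ⟦⟧-neg : ∀ i → ⟦ ℤ.- i ⟧ℤ ≈ - ⟦ i ⟧ℤ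
  ⟦⟧-neg (+ zero)    = ≈-sym -0#≈0#
  ⟦⟧-neg (+ suc n)   = ≈-refl
  ⟦⟧-neg -[1+ n ]    = ≈-sym (-‿involutive _)

  ⟦⟧-⊖ : ∀ m n → ⟦ m ⊖ n ⟧ℤ ≈ m · 1# - n · 1#
  ⟦⟧-⊖ zero    zero    = ≈-sym (≈-trans (+-congˡ -0#≈0#) (+-identityʳ _))
  ⟦⟧-⊖ (suc m) zero    = ≈-sym (≈-trans (+-congˡ -0#≈0#) (+-identityʳ _))
  ⟦⟧-⊖ zero    (suc n) = ≈-sym (+-identityˡ _)
  ⟦⟧-⊖ (suc m) (suc n) = begin
    ⟦ suc m ⊖ suc n ⟧ℤ             ≡⟨ cong ⟦_⟧ℤ (ℤ.[1+m]⊖[1+n]≡m⊖n m n) ⟩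
    ⟦ m ⊖ n ⟧ℤ                     ≈⟨ ⟦⟧-⊖ m n ⟩
    m · 1# - n · 1#                ≈⟨ cancel (m · 1#) (n · 1#) ⟨
    (1# + m · 1#) - (1# + n · 1#)  ≈⟨ +-cong (1+× m 1#) (-‿cong (1+× n 1#)) ⟨
    suc m · 1# - suc n · 1#        ∎
    where
    cancel : ∀ a b → (1# + a) - (1# + b) ≈ a - b
    cancel a b = begin
      (1# + a) - (1# + b)      ≈⟨ +-congˡ (≈-sym (-‿+-comm 1# b)) ⟩
      (1# + a) + (- 1# - b)    ≈⟨ +-congʳ (+-comm 1# a) ⟩
      (a + 1#) + (- 1# - b)    ≈⟨ +-assoc a 1# _ ⟩
      a + (1# + (- 1# - b))    ≈⟨ +-congˡ (≈-sym (+-assoc 1# (- 1#) (- b))) ⟩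
      a + ((1# - 1#) - b)      ≈⟨ +-congˡ (+-congʳ (-‿inverseʳ 1#)) ⟩
      a + (0# - b)             ≈⟨ +-congˡ (+-identityˡ _) ⟩
      a - b                    ∎

  ⟦⟧-+ : ∀ i j → ⟦ i ℤ.+ j ⟧ℤ ≈ ⟦ i ⟧ℤ + ⟦ j ⟧ℤ
  ⟦⟧-+ -[1+ m ] -[1+ n ] = begin
    - (suc (suc (m ℕ.+ n)) · 1#)      ≡⟨ cong (λ k → - (suc k · 1#)) (ℕ.+-suc m n) ⟨
    - ((suc m ℕ.+ suc n) · 1#)        ≈⟨ -‿cong (×-homo-+ 1# (suc m) (suc n)) ⟩
    - (suc m · 1# + suc n · 1#)       ≈⟨ -‿+-comm _ _ ⟨
    - (suc m · 1#) + - (suc n · 1#)   ∎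
  ⟦⟧-+ -[1+ m ] (+ n)    = ≈-trans (⟦⟧-⊖ n (suc m)) (+-comm _ _)
  ⟦⟧-+ (+ m)    -[1+ n ] = ⟦⟧-⊖ m (suc n)
  ⟦⟧-+ (+ m)    (+ n)    = ×-homo-+ 1# m n

  ⟦⟧-*-pos : ∀ m j → ⟦ + m ℤ.* j ⟧ℤ ≈ ⟦ + m ⟧ℤ * ⟦ j ⟧ℤ
  ⟦⟧-*-pos m (+ n)    = ≈-trans (reflexive (cong ⟦_⟧ℤ (sym (ℤ.pos-* m n)))) (×1-homo-* m n)
  ⟦⟧-*-pos m -[1+ n ] = begin
    ⟦ + m ℤ.* -[1+ n ] ⟧ℤ            ≡⟨ cong ⟦_⟧ℤ (ℤ.neg-distribʳ-* (+ m) (+ suc n)) ⟨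
    ⟦ ℤ.- (+ m ℤ.* + suc n) ⟧ℤ        ≈⟨ ⟦⟧-neg (+ m ℤ.* + suc n) ⟩
    - ⟦ + m ℤ.* + suc n ⟧ℤ            ≈⟨ -‿cong (⟦⟧-*-pos m (+ suc n)) ⟩
    - (⟦ + m ⟧ℤ * ⟦ + suc n ⟧ℤ)        ≈⟨ -‿distribʳ-* _ _ ⟩
    ⟦ + m ⟧ℤ * ⟦ -[1+ n ] ⟧ℤ          ∎

  ⟦⟧-* : ∀ i j → ⟦ i ℤ.* j ⟧ℤ ≈ ⟦ i ⟧ℤ * ⟦ j ⟧ℤ
  ⟦⟧-* (+ m)    j = ⟦⟧-*-pos m j
  ⟦⟧-* -[1+ m ] j = begin
    ⟦ -[1+ m ] ℤ.* j ⟧ℤ              ≡⟨ cong ⟦_⟧ℤ (ℤ.neg-distribˡ-* (+ suc m) j) ⟨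
    ⟦ ℤ.- (+ suc m ℤ.* j) ⟧ℤ          ≈⟨ ⟦⟧-neg (+ suc m ℤ.* j) ⟩
    - ⟦ + suc m ℤ.* j ⟧ℤ              ≈⟨ -‿cong (⟦⟧-*-pos (suc m) j) ⟩
    - (⟦ + suc m ⟧ℤ * ⟦ j ⟧ℤ)          ≈⟨ -‿distribˡ-* _ _ ⟩
    ⟦ -[1+ m ] ⟧ℤ * ⟦ j ⟧ℤ            ∎

  ℤ-rawRing : RawRing _ _
  ℤ-rawRing = record { Carrier = ℤ ; _≈_ = _≡_ ; _+_ = ℤ._+_ ; _*_ = ℤ._*_ ; -_ = ℤ.-_ ; 0# = + 0 ; 1# = + 1 }

  ℤ-coefficients : ℤ-rawRing ACR.-Raw-AlmostCommutative⟶ ACR.fromCommutativeRing R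
  ℤ-coefficients = record
    { ⟦_⟧ = ⟦_⟧ℤ ; +-homo = ⟦⟧-+ ; *-homo = ⟦⟧-* ; -‿homo = ⟦⟧-neg
    ; 0-homo = ≈-refl ; 1-homo = ≈-refl }

  ≟-coefficients : ∀ i j → Maybe (⟦ i ⟧ℤ ≈ ⟦ j ⟧ℤ)
  ≟-coefficients i j with i ℤ.≟ j
  ... | yes refl = just ≈-refl
  ... | no _     = nothing

  open import Algebra.Solver.Ring ℤ-rawRing (ACR.fromCommutativeRing R) ℤ-coefficients ≟-coefficients public

module RealFieldProperties (R : RealField) where
  open RealField R public

  commutativeRing : CommutativeRing 0ℓ 0ℓ
  commutativeRing = record { isCommutativeRing = isCommutativeRing }

  open CommutativeRing commutativeRing public
    using (+-assoc; +-comm; +-identityˡ; +-identityʳ; -‿inverseʳ; *-assoc; *-comm; *-identityˡ; *-identityʳ; zeroˡ; zeroʳ)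
  open import Algebra.Properties.Ring (CommutativeRing.ring commutativeRing) public
    using (-‿involutive; -0#≈0#)
  open IntegerCoefficients commutativeRing using (solve; _:+_; _:*_; _:-_; :-_; _:=_; con)

  <-irrefl : ∀ {x} → ¬ x < x
  <-irrefl {x} x<x with <-cmp x x
  ... | tri< _ x≢x _ = x≢x refl
  ... | tri≈ x≮x _ _ = x≮x x<x
  ... | tri> _ x≢x _ = x≢x refl

  <-asym : ∀ {x y} → x < y → ¬ y < x
  <-asym x<y y<x = <-irrefl (<-trans x<y y<x)

  <⇒≢ : ∀ {x y} → x < y → x ≢ y
  <⇒≢ x<y refl = <-irrefl x<y

  ≤-<-trans : ∀ {x y z} → x ≤ y → y < z → x < z
  ≤-<-trans (inj₁ x<y) y<z = <-trans x<y y<z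
  ≤-<-trans (inj₂ refl) y<z = y<z

  <-≤-trans : ∀ {x y z} → x < y → y ≤ z → x < z
  <-≤-trans x<y (inj₁ y<z) = <-trans x<y y<z
  <-≤-trans x<y (inj₂ refl) = x<y

  ≤-trans : ∀ {x y z} → x ≤ y → y ≤ z → x ≤ z
  ≤-trans (inj₁ x<y) y≤z = inj₁ (<-≤-trans x<y y≤z)
  ≤-trans (inj₂ refl) y≤z = y≤z

  ≤⇒≯ : ∀ {x y} → x ≤ y → ¬ y < x
  ≤⇒≯ (inj₁ x<y) = <-asym x<y
  ≤⇒≯ (inj₂ refl) = <-irrefl

  ≮⇒≥ : ∀ {x y} → ¬ x < y → y ≤ x
  ≮⇒≥ {x} {y} x≮y with <-cmp x y
  ... | tri< x<y _ _ = ⊥-elim (x≮y x<y)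
  ... | tri≈ _ x≡y _ = inj₂ (sym x≡y)
  ... | tri> _ _ y<x = inj₁ y<x

  _≟_ : (x y : ℝ) → Dec (x ≡ y)
  x ≟ y with <-cmp x y
  ... | tri< _ x≢y _ = no x≢y
  ... | tri≈ _ x≡y _ = yes x≡y
  ... | tri> _ x≢y _ = no x≢y

  x-y≡0⇒x≡y : ∀ {x y} → x - y ≡ 0r → x ≡ y
  x-y≡0⇒x≡y {x} {y} x-y≡0 = begin
    x                ≡⟨ solve 2 (λ x y → x := (x :- y) :+ y) refl x y ⟩
    (x - y) + y      ≡⟨ cong (_+ y) x-y≡0 ⟩
    0r + y           ≡⟨ +-identityˡ y ⟩
    y                ∎
    where open ≡-Reasoning

  x<y⇒0<y-x : ∀ {x y} → x < y → 0r < y - x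
  x<y⇒0<y-x {x} {y} x<y = subst (_< y - x) (-‿inverseʳ x) (+-mono-< (- x) x<y)

  0<y-x⇒x<y : ∀ {x y} → 0r < y - x → x < y
  0<y-x⇒x<y {x} {y} 0<y-x = subst₂ _<_ (+-identityˡ x) (solve 2 (λ x y → (y :- x) :+ x := y) refl x y) (+-mono-< x 0<y-x)

  x≤y⇒0≤y-x : ∀ {x y} → x ≤ y → 0r ≤ y - x
  x≤y⇒0≤y-x (inj₁ x<y) = inj₁ (x<y⇒0<y-x x<y)
  x≤y⇒0≤y-x {x} (inj₂ refl) = inj₂ (sym (-‿inverseʳ x))

  0≤y-x⇒x≤y : ∀ {x y} → 0r ≤ y - x → x ≤ y
  0≤y-x⇒x≤y (inj₁ 0<y-x) = inj₁ (0<y-x⇒x<y 0<y-x)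
  0≤y-x⇒x≤y (inj₂ 0≡y-x) = inj₂ (sym (x-y≡0⇒x≡y (sym 0≡y-x)))

  x<0⇒0<-x : ∀ {x} → x < 0r → 0r < - x
  x<0⇒0<-x {x} x<0 = subst (0r <_) (+-identityˡ (- x)) (x<y⇒0<y-x x<0)

  0<-x⇒x<0 : ∀ {x} → 0r < - x → x < 0r
  0<-x⇒x<0 {x} 0<-x = 0<y-x⇒x<y (subst (0r <_) (sym (+-identityˡ (- x))) 0<-x)

  0<x⇒-x<0 : ∀ {x} → 0r < x → - x < 0r
  0<x⇒-x<0 {x} 0<x = 0<-x⇒x<0 (subst (0r <_) (sym (-‿involutive x)) 0<x)

  +-pos : ∀ {a b} → 0r < a → 0r < b → 0r < a + b
  +-pos {a} {b} 0<a 0<b = <-trans 0<b (subst (_< a + b) (+-identityˡ b) (+-mono-< b 0<a))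

  +-pos-nonNeg : ∀ {a b} → 0r < a → 0r ≤ b → 0r < a + b
  +-pos-nonNeg 0<a (inj₁ 0<b) = +-pos 0<a 0<b
  +-pos-nonNeg {a} 0<a (inj₂ refl) = subst (0r <_) (sym (+-identityʳ a)) 0<a

  +-nonNeg : ∀ {a b} → 0r ≤ a → 0r ≤ b → 0r ≤ a + b
  +-nonNeg {a} {b} (inj₁ 0<a) 0≤b = inj₁ (+-pos-nonNeg 0<a 0≤b)
  +-nonNeg {b = b} (inj₂ refl) 0≤b = subst (0r ≤_) (sym (+-identityˡ b)) 0≤b

  *-nonNeg : ∀ {a b} → 0r ≤ a → 0r ≤ b → 0r ≤ a * b
  *-nonNeg (inj₁ 0<a) (inj₁ 0<b) = inj₁ (*-pos 0<a 0<b)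
  *-nonNeg {a} (inj₁ _) (inj₂ refl) = inj₂ (sym (zeroʳ a))
  *-nonNeg {b = b} (inj₂ refl) _ = inj₂ (sym (zeroˡ b))

  neg*neg : ∀ x → - x * - x ≡ x * x
  neg*neg = solve 1 (λ x → (:- x) :* (:- x) := x :* x) refl

  square-pos : ∀ {a} → a ≢ 0r → 0r < a * a
  square-pos {a} a≢0 with <-cmp 0r a
  ... | tri< 0<a _ _ = *-pos 0<a 0<a
  ... | tri≈ _ 0≡a _ = ⊥-elim (a≢0 (sym 0≡a))
  ... | tri> _ _ a<0 = subst (0r <_) (neg*neg a) (*-pos (x<0⇒0<-x a<0) (x<0⇒0<-x a<0))

  square-nonNeg : ∀ a → 0r ≤ a * a
  square-nonNeg a with a ≟ 0r
  ... | yes refl = inj₂ (sym (zeroˡ 0r))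
  ... | no a≢0 = inj₁ (square-pos a≢0)

  0<1 : 0r < 1r
  0<1 = subst (0r <_) (*-identityˡ 1r) (square-pos (λ 1≡0 → 0≢1 (sym 1≡0)))

  sum-of-squares-zero : ∀ a b → a * a + b * b ≡ 0r → a ≡ 0r
  sum-of-squares-zero a b a²+b²≡0 with a ≟ 0r
  ... | yes a≡0 = a≡0
  ... | no a≢0 = ⊥-elim (<⇒≢ (+-pos-nonNeg (square-pos a≢0) (square-nonNeg b)) (sym a²+b²≡0))

  zero-product : ∀ {a b} → a * b ≡ 0r → a ≡ 0r ⊎ b ≡ 0r
  zero-product {a} {b} ab≡0 with a ≟ 0r
  ... | yes a≡0 = inj₁ a≡0
  ... | no a≢0 with inverse a a≢0
  ...   | a⁻¹ , aa⁻¹≡1 = inj₂ (begin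
    b                  ≡⟨ *-identityˡ b ⟨
    1r * b             ≡⟨ cong (_* b) aa⁻¹≡1 ⟨
    (a * a⁻¹) * b      ≡⟨ solve 3 (λ a a⁻¹ b → (a :* a⁻¹) :* b := a⁻¹ :* (a :* b)) refl a a⁻¹ b ⟩
    a⁻¹ * (a * b)      ≡⟨ cong (a⁻¹ *_) ab≡0 ⟩
    a⁻¹ * 0r           ≡⟨ zeroʳ a⁻¹ ⟩
    0r                 ∎)
    where open ≡-Reasoning

  x+x≡0⇒x≡0 : ∀ {x} → x + x ≡ 0r → x ≡ 0r
  x+x≡0⇒x≡0 {x} x+x≡0 with zero-product (trans (solve 1 (λ x → (con (+ 1) :+ con (+ 1)) :* x := x :+ x) refl x) x+x≡0)
  ... | inj₁ 2≡0 = ⊥-elim (<⇒≢ (+-pos 0<1 0<1) (sym 2≡0))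
  ... | inj₂ x≡0 = x≡0

  half-nonNeg : ∀ {x} → 0r ≤ x + x → 0r ≤ x
  half-nonNeg {x} 0≤2x with <-cmp 0r x
  ... | tri< 0<x _ _ = inj₁ 0<x
  ... | tri≈ _ 0≡x _ = inj₂ 0≡x
  ... | tri> _ _ x<0 = ⊥-elim (≤⇒≯ 0≤2x (0<-x⇒x<0 (subst (0r <_) (solve 1 (λ x → (:- x) :+ (:- x) := :- (x :+ x)) refl x)
                                                  (+-pos (x<0⇒0<-x x<0) (x<0⇒0<-x x<0)))))

  inverse-pos : ∀ {a b} → 0r < a → a * b ≡ 1r → 0r < b
  inverse-pos {a} {b} 0<a ab≡1 with <-cmp 0r b
  ... | tri< 0<b _ _ = 0<b
  ... | tri≈ _ 0≡b _ = ⊥-elim (0≢1 (trans (trans (sym (zeroʳ a)) (cong (a *_) 0≡b)) ab≡1))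
  ... | tri> _ _ b<0 = ⊥-elim (<-asym 0<1 (subst (_< 0r) ab≡1 (0<-x⇒x<0 (subst (0r <_) (solve 2 (λ a b → a :* (:- b) := :- (a :* b)) refl a b)
                                                                            (*-pos 0<a (x<0⇒0<-x b<0))))))

  ≤-antisym : ∀ {x y} → x ≤ y → y ≤ x → x ≡ y
  ≤-antisym (inj₂ x≡y) _ = x≡y
  ≤-antisym (inj₁ _) (inj₂ y≡x) = sym y≡x
  ≤-antisym (inj₁ x<y) (inj₁ y<x) = ⊥-elim (<-asym x<y y<x)

  <-stable : ∀ {x y} → ¬ ¬ x < y → x < y
  <-stable {x} {y} ¬¬x<y with <-cmp x y
  ... | tri< x<y _ _ = x<y
  ... | tri≈ x≮y _ _ = ⊥-elim (¬¬x<y x≮y)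
  ... | tri> x≮y _ _ = ⊥-elim (¬¬x<y x≮y)

  min-pos : ∀ {a b} → 0r < a → 0r < b → ∃ λ c → 0r < c × c ≤ a × c ≤ b
  min-pos {a} {b} 0<a 0<b with <-cmp a b
  ... | tri< a<b _ _ = a , 0<a , inj₂ refl , inj₁ a<b
  ... | tri≈ _ refl _ = a , 0<a , inj₂ refl , inj₂ refl
  ... | tri> _ _ b<a = b , 0<b , inj₁ b<a , inj₂ refl

  ≤∧≢⇒< : ∀ {x y} → x ≤ y → x ≢ y → x < y
  ≤∧≢⇒< (inj₁ x<y) _ = x<y
  ≤∧≢⇒< (inj₂ x≡y) x≢y = ⊥-elim (x≢y x≡y)

  +-mono-≤ : ∀ {a b c d} → a ≤ b → c ≤ d → a + c ≤ b + d
  +-mono-≤ {a} {b} {c} {d} a≤b c≤d = 0≤y-x⇒x≤y (subst (0r ≤_) (solve 4 (λ a b c d → (b :- a) :+ (d :- c) := (b :+ d) :- (a :+ c)) refl a b c d)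
                                                        (+-nonNeg (x≤y⇒0≤y-x a≤b) (x≤y⇒0≤y-x c≤d)))

  -‿monoˡ-≤ : ∀ {x y} z → x ≤ y → x - z ≤ y - z
  -‿monoˡ-≤ {x} {y} z x≤y = 0≤y-x⇒x≤y (subst (0r ≤_) (solve 3 (λ x y z → y :- x := (y :- z) :- (x :- z)) refl x y z) (x≤y⇒0≤y-x x≤y))

  ratio : ∀ {a₁ b₁ a₂ b₂} → 0r ≤ a₁ → a₁ ≤ a₂ → 0r < a₂ → a₁ * b₂ ≡ b₁ * a₂ →
          ∃ λ t → 0r ≤ t × t ≤ 1r × a₁ ≡ t * a₂ × b₁ ≡ t * b₂
  ratio {a₁} {b₁} {a₂} {b₂} 0≤a₁ a₁≤a₂ 0<a₂ a₁b₂≡b₁a₂ = scale (inverse a₂ (<⇒≢ 0<a₂ ∘ sym))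
    where
    open ≡-Reasoning
    scale : (∃ λ k → a₂ * k ≡ 1r) → ∃ λ t → 0r ≤ t × t ≤ 1r × a₁ ≡ t * a₂ × b₁ ≡ t * b₂
    scale (k , a₂k≡1) = a₁ * k , *-nonNeg 0≤a₁ (inj₁ 0<k) , t≤1 , a₁≡ta₂ , b₁≡tb₂
      where
      0<k : 0r < k
      0<k = inverse-pos 0<a₂ a₂k≡1
      1-t : (a₂ - a₁) * k ≡ 1r - a₁ * k
      1-t = begin
        (a₂ - a₁) * k       ≡⟨ solve 3 (λ a₁ a₂ k → (a₂ :- a₁) :* k := a₂ :* k :- a₁ :* k) refl a₁ a₂ k ⟩
        a₂ * k - a₁ * k     ≡⟨ cong (_- a₁ * k) a₂k≡1 ⟩
        1r - a₁ * k         ∎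
      t≤1 : a₁ * k ≤ 1r
      t≤1 = 0≤y-x⇒x≤y (subst (0r ≤_) 1-t (*-nonNeg (x≤y⇒0≤y-x a₁≤a₂) (inj₁ 0<k)))
      a₁≡ta₂ : a₁ ≡ a₁ * k * a₂
      a₁≡ta₂ = begin
        a₁                  ≡⟨ *-identityʳ a₁ ⟨
        a₁ * 1r             ≡⟨ cong (a₁ *_) a₂k≡1 ⟨
        a₁ * (a₂ * k)       ≡⟨ solve 3 (λ a₁ a₂ k → a₁ :* (a₂ :* k) := a₁ :* k :* a₂) refl a₁ a₂ k ⟩
        a₁ * k * a₂         ∎
      b₁≡tb₂ : b₁ ≡ a₁ * k * b₂
      b₁≡tb₂ = begin
        b₁                  ≡⟨ *-identityʳ b₁ ⟨
        b₁ * 1r             ≡⟨ cong (b₁ *_) a₂k≡1 ⟨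
        b₁ * (a₂ * k)       ≡⟨ *-assoc b₁ a₂ k ⟨
        (b₁ * a₂) * k       ≡⟨ cong (_* k) a₁b₂≡b₁a₂ ⟨
        (a₁ * b₂) * k       ≡⟨ solve 3 (λ a₁ b₂ k → (a₁ :* b₂) :* k := a₁ :* k :* b₂) refl a₁ b₂ k ⟩
        a₁ * k * b₂         ∎

module Complex (R : RealField) where
  open RealFieldProperties R
  open IntegerCoefficients commutativeRing using (solve; _:+_; _:*_; _:-_; :-_; _:=_; con)
  open Plane R using (Point)

  re im : Point → ℝ
  re = proj₁
  im = proj₂

  infixl 6 _+ᶜ_ _-ᶜ_
  infixl 7 _*ᶜ_
  infix  8 -ᶜ_

  _+ᶜ_ _*ᶜ_ : Point → Point → Point
  (a , b) +ᶜ (c , d) = (a + c , b + d)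
  (a , b) *ᶜ (c , d) = (a * c - b * d , a * d + b * c)

  -ᶜ_ : Point → Point
  -ᶜ_ (a , b) = (- a , - b)

  _-ᶜ_ : Point → Point → Point
  z -ᶜ w = z +ᶜ -ᶜ w

  0ᶜ 1ᶜ : Point
  0ᶜ = (0r , 0r)
  1ᶜ = (1r , 0r)

  conj : Point → Point
  conj (a , b) = (a , - b)

  ∣_∣² : Point → ℝ
  ∣ (a , b) ∣² = a * a + b * b

  ℂ-ext : ∀ {z w} → re z ≡ re w → im z ≡ im w → z ≡ w
  ℂ-ext = cong₂ _,_

  +ᶜ-assoc : ∀ z w u → (z +ᶜ w) +ᶜ u ≡ z +ᶜ (w +ᶜ u)
  +ᶜ-assoc (a , b) (c , d) (e , f) = ℂ-ext (+-assoc a c e) (+-assoc b d f)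

  +ᶜ-comm : ∀ z w → z +ᶜ w ≡ w +ᶜ z
  +ᶜ-comm (a , b) (c , d) = ℂ-ext (+-comm a c) (+-comm b d)

  +ᶜ-identityˡ : ∀ z → 0ᶜ +ᶜ z ≡ z
  +ᶜ-identityˡ (a , b) = ℂ-ext (+-identityˡ a) (+-identityˡ b)

  -ᶜ-inverseˡ : ∀ z → -ᶜ z +ᶜ z ≡ 0ᶜ
  -ᶜ-inverseˡ (a , b) = ℂ-ext (trans (+-comm (- a) a) (-‿inverseʳ a)) (trans (+-comm (- b) b) (-‿inverseʳ b))

  *ᶜ-assoc : ∀ z w u → (z *ᶜ w) *ᶜ u ≡ z *ᶜ (w *ᶜ u)
  *ᶜ-assoc (a , b) (c , d) (e , f) = ℂ-ext
    (solve 6 (λ a b c d e f → (a :* c :- b :* d) :* e :- (a :* d :+ b :* c) :* f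
                              := a :* (c :* e :- d :* f) :- b :* (c :* f :+ d :* e)) refl a b c d e f)
    (solve 6 (λ a b c d e f → (a :* c :- b :* d) :* f :+ (a :* d :+ b :* c) :* e
                              := a :* (c :* f :+ d :* e) :+ b :* (c :* e :- d :* f)) refl a b c d e f)

  *ᶜ-comm : ∀ z w → z *ᶜ w ≡ w *ᶜ z
  *ᶜ-comm (a , b) (c , d) = ℂ-ext
    (solve 4 (λ a b c d → a :* c :- b :* d := c :* a :- d :* b) refl a b c d)
    (solve 4 (λ a b c d → a :* d :+ b :* c := c :* b :+ d :* a) refl a b c d)

  *ᶜ-identityˡ : ∀ z → 1ᶜ *ᶜ z ≡ z
  *ᶜ-identityˡ (a , b) = ℂ-ext
    (solve 2 (λ a b → con (+ 1) :* a :- con (+ 0) :* b := a) refl a b)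
    (solve 2 (λ a b → con (+ 1) :* b :+ con (+ 0) :* a := b) refl a b)

  *ᶜ-distribʳ : ∀ u z w → (z +ᶜ w) *ᶜ u ≡ z *ᶜ u +ᶜ w *ᶜ u
  *ᶜ-distribʳ (e , f) (a , b) (c , d) = ℂ-ext
    (solve 6 (λ a b c d e f → (a :+ c) :* e :- (b :+ d) :* f := (a :* e :- b :* f) :+ (c :* e :- d :* f)) refl a b c d e f)
    (solve 6 (λ a b c d e f → (a :+ c) :* f :+ (b :+ d) :* e := (a :* f :+ b :* e) :+ (c :* f :+ d :* e)) refl a b c d e f)

  ℂ-isCommutativeRing : IsCommutativeRing _≡_ _+ᶜ_ _*ᶜ_ -ᶜ_ 0ᶜ 1ᶜ
  ℂ-isCommutativeRing = record
    { isRing = record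
      { +-isAbelianGroup = record
        { isGroup = record
          { isMonoid = record
            { isSemigroup = record
              { isMagma = record { isEquivalence = isEquivalence ; ∙-cong = cong₂ _+ᶜ_ }
              ; assoc = +ᶜ-assoc }
            ; identity = +ᶜ-identityˡ , λ z → trans (+ᶜ-comm z 0ᶜ) (+ᶜ-identityˡ z) }
          ; inverse = -ᶜ-inverseˡ , λ z → trans (+ᶜ-comm z (-ᶜ z)) (-ᶜ-inverseˡ z)
          ; ⁻¹-cong = cong (-ᶜ_) }
        ; comm = +ᶜ-comm }
      ; *-cong = cong₂ _*ᶜ_
      ; *-assoc = *ᶜ-assoc
      ; *-identity = *ᶜ-identityˡ , λ z → trans (*ᶜ-comm z 1ᶜ) (*ᶜ-identityˡ z)
      ; distrib = (λ u z w → trans (*ᶜ-comm u (z +ᶜ w)) (trans (*ᶜ-distribʳ u z w) (cong₂ _+ᶜ_ (*ᶜ-comm z u) (*ᶜ-comm w u))))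
                , *ᶜ-distribʳ }
    ; *-comm = *ᶜ-comm }

  ℂ-commutativeRing : CommutativeRing 0ℓ 0ℓ
  ℂ-commutativeRing = record { isCommutativeRing = ℂ-isCommutativeRing }

  open CommutativeRing ℂ-commutativeRing public using () renaming (*-identityʳ to *ᶜ-identityʳ)

  open import Algebra.Properties.Semiring.Exp (CommutativeRing.semiring ℂ-commutativeRing) public
    using (_^_; ^-homo-*; ^-assocʳ)

  conj-+ : ∀ z w → conj (z +ᶜ w) ≡ conj z +ᶜ conj w
  conj-+ (a , b) (c , d) = ℂ-ext refl (solve 2 (λ b d → :- (b :+ d) := :- b :+ :- d) refl b d)

  conj-* : ∀ z w → conj (z *ᶜ w) ≡ conj z *ᶜ conj w
  conj-* (a , b) (c , d) = ℂ-ext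
    (solve 4 (λ a b c d → a :* c :- b :* d := a :* c :- (:- b) :* (:- d)) refl a b c d)
    (solve 4 (λ a b c d → :- (a :* d :+ b :* c) := a :* (:- d) :+ (:- b) :* c) refl a b c d)

  conj-involutive : ∀ z → conj (conj z) ≡ z
  conj-involutive (a , b) = ℂ-ext refl (-‿involutive b)

  *ᶜ-conj : ∀ z → z *ᶜ conj z ≡ (∣ z ∣² , 0r)
  *ᶜ-conj (a , b) = ℂ-ext
    (solve 2 (λ a b → a :* a :- b :* (:- b) := a :* a :+ b :* b) refl a b)
    (solve 2 (λ a b → a :* (:- b) :+ b :* a := con (+ 0)) refl a b)

  ∣∣²-* : ∀ z w → ∣ z *ᶜ w ∣² ≡ ∣ z ∣² * ∣ w ∣²
  ∣∣²-* (a , b) (c , d) = solve 4 (λ a b c d →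
    (a :* c :- b :* d) :* (a :* c :- b :* d) :+ (a :* d :+ b :* c) :* (a :* d :+ b :* c)
      := (a :* a :+ b :* b) :* (c :* c :+ d :* d)) refl a b c d

  ∣∣²≡0⇒≡0 : ∀ z → ∣ z ∣² ≡ 0r → z ≡ 0ᶜ
  ∣∣²≡0⇒≡0 (a , b) ∣z∣²≡0 =
    ℂ-ext (sum-of-squares-zero a b ∣z∣²≡0) (sum-of-squares-zero b a (trans (+-comm (b * b) (a * a)) ∣z∣²≡0))

  ∣0ᶜ∣²≡0 : ∣ 0ᶜ ∣² ≡ 0r
  ∣0ᶜ∣²≡0 = solve 0 (con (+ 0) :* con (+ 0) :+ con (+ 0) :* con (+ 0) := con (+ 0)) refl

  *ᶜ-zero-product : ∀ {z w} → z *ᶜ w ≡ 0ᶜ → z ≡ 0ᶜ ⊎ w ≡ 0ᶜ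
  *ᶜ-zero-product {z} {w} zw≡0 with zero-product (trans (sym (∣∣²-* z w)) (trans (cong ∣_∣² zw≡0) ∣0ᶜ∣²≡0))
  ... | inj₁ ∣z∣²≡0 = inj₁ (∣∣²≡0⇒≡0 z ∣z∣²≡0)
  ... | inj₂ ∣w∣²≡0 = inj₂ (∣∣²≡0⇒≡0 w ∣w∣²≡0)

  ofℝ : ℝ → Point
  ofℝ a = (a , 0r)

  ofℝ-* : ∀ a b → ofℝ a *ᶜ ofℝ b ≡ ofℝ (a * b)
  ofℝ-* a b = ℂ-ext (solve 2 (λ a b → a :* b :- con (+ 0) :* con (+ 0) := a :* b) refl a b)
                    (solve 2 (λ a b → a :* con (+ 0) :+ con (+ 0) :* b := con (+ 0)) refl a b)

  im-ofℝ-* : ∀ a z → im (ofℝ a *ᶜ z) ≡ a * im z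
  im-ofℝ-* a (x , y) = solve 3 (λ a x y → a :* y :+ con (+ 0) :* x := a :* y) refl a x y

  OnUnitCircle : Point → Set
  OnUnitCircle z = ∣ z ∣² ≡ 1r

  OnUnitCircle-1ᶜ : OnUnitCircle 1ᶜ
  OnUnitCircle-1ᶜ = solve 0 (con (+ 1) :* con (+ 1) :+ con (+ 0) :* con (+ 0) := con (+ 1)) refl

  OnUnitCircle-*ᶜ : ∀ {z w} → OnUnitCircle z → OnUnitCircle w → OnUnitCircle (z *ᶜ w)
  OnUnitCircle-*ᶜ {z} {w} ∣z∣≡1 ∣w∣≡1 = trans (∣∣²-* z w) (trans (cong₂ _*_ ∣z∣≡1 ∣w∣≡1) (*-identityˡ 1r))

  OnUnitCircle-^ : ∀ {z} → OnUnitCircle z → ∀ k → OnUnitCircle (z ^ k)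
  OnUnitCircle-^ ∣z∣≡1 zero    = OnUnitCircle-1ᶜ
  OnUnitCircle-^ ∣z∣≡1 (suc k) = OnUnitCircle-*ᶜ ∣z∣≡1 (OnUnitCircle-^ ∣z∣≡1 k)

  OnUnitCircle-neg : ∀ {z} → OnUnitCircle z → OnUnitCircle (-ᶜ z)
  OnUnitCircle-neg {a , b} = trans (cong₂ _+_ (neg*neg a) (neg*neg b))

  OnUnitCircle⇒≢0ᶜ : ∀ {z} → OnUnitCircle z → z ≢ 0ᶜ
  OnUnitCircle⇒≢0ᶜ ∣z∣≡1 refl = 0≢1 (trans (sym ∣0ᶜ∣²≡0) ∣z∣≡1)

  OnUnitCircle⇒*ᶜ-conj : ∀ {z} → OnUnitCircle z → z *ᶜ conj z ≡ 1ᶜ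
  OnUnitCircle⇒*ᶜ-conj {z} ∣z∣≡1 = trans (*ᶜ-conj z) (cong (_, 0r) ∣z∣≡1)

  -- The tangent at u supports the circle: twice the left-hand side is ∣ u - w ∣².
  OnUnitCircle-supporting : ∀ {u w} → OnUnitCircle u → OnUnitCircle w →
                            0r ≤ re (-ᶜ u) * (re w - re u) + im (-ᶜ u) * (im w - im u)
  OnUnitCircle-supporting {u₁ , u₂} {w₁ , w₂} ∣u∣≡1 ∣w∣≡1 =
    half-nonNeg (subst (0r ≤_) (sym twice) (+-nonNeg (square-nonNeg (u₁ - w₁)) (square-nonNeg (u₂ - w₂))))
    where
    open ≡-Reasoning
    s d : ℝ
    s = - u₁ * (w₁ - u₁) + - u₂ * (w₂ - u₂)
    d = (u₁ - w₁) * (u₁ - w₁) + (u₂ - w₂) * (u₂ - w₂)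
    twice : s + s ≡ d
    twice = begin
      s + s                  ≡⟨ solve 4 (λ u₁ u₂ w₁ w₂ →
                                  (:- u₁ :* (w₁ :- u₁) :+ :- u₂ :* (w₂ :- u₂)) :+ (:- u₁ :* (w₁ :- u₁) :+ :- u₂ :* (w₂ :- u₂))
                                  := (u₁ :- w₁) :* (u₁ :- w₁) :+ (u₂ :- w₂) :* (u₂ :- w₂)
                                     :+ ((u₁ :* u₁ :+ u₂ :* u₂) :- (w₁ :* w₁ :+ w₂ :* w₂))) refl u₁ u₂ w₁ w₂ ⟩
      d + (∣ (u₁ , u₂) ∣² - ∣ (w₁ , w₂) ∣²)  ≡⟨ cong₂ (λ U W → d + (U - W)) ∣u∣≡1 ∣w∣≡1 ⟩
      d + (1r - 1r)          ≡⟨ cong (λ x → d + x) (-‿inverseʳ 1r) ⟩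
      d + 0r                 ≡⟨ +-identityʳ d ⟩
      d                      ∎

  cross≡im-conj-* : ∀ o p q → Plane.cross R o p q ≡ im (conj (p -ᶜ o) *ᶜ (q -ᶜ o))
  cross≡im-conj-* (o₁ , o₂) (p₁ , p₂) (q₁ , q₂) = solve 6 (λ o₁ o₂ p₁ p₂ q₁ q₂ →
    (p₁ :- o₁) :* (q₂ :- o₂) :- (p₂ :- o₂) :* (q₁ :- o₁) := (p₁ :- o₁) :* (q₂ :- o₂) :+ (:- (p₂ :- o₂)) :* (q₁ :- o₁))
    refl o₁ o₂ p₁ p₂ q₁ q₂

  im-conj-*≡0⇒parallel : ∀ d d′ → im (conj d *ᶜ d′) ≡ 0r → re d * im d′ ≡ im d * re d′
  im-conj-*≡0⇒parallel (a , b) (c , d) im≡0 = begin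
    a * d                        ≡⟨ solve 4 (λ a b c d → a :* d := (a :* d :+ (:- b) :* c) :+ b :* c) refl a b c d ⟩
    (a * d + (- b) * c) + b * c  ≡⟨ cong (_+ b * c) im≡0 ⟩
    0r + b * c                   ≡⟨ +-identityˡ (b * c) ⟩
    b * c                        ∎
    where open ≡-Reasoning

  OnSegment⇒collinear : ∀ {u v w} → Plane.OnSegment R u v w → Plane.Collinear R u v w
  OnSegment⇒collinear {u₁ , u₂} {v₁ , v₂} {w₁ , w₂} (t , _ , _ , w₁≡ , w₂≡) = begin
    (v₁ - u₁) * (w₂ - u₂) - (v₂ - u₂) * (w₁ - u₁)  ≡⟨ cong₂ F w₁≡ w₂≡ ⟩
    F (u₁ + t * (v₁ - u₁)) (u₂ + t * (v₂ - u₂))    ≡⟨ solve 5 (λ u₁ u₂ v₁ v₂ t →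
      (v₁ :- u₁) :* ((u₂ :+ t :* (v₂ :- u₂)) :- u₂) :- (v₂ :- u₂) :* ((u₁ :+ t :* (v₁ :- u₁)) :- u₁) := con (+ 0))
      refl u₁ u₂ v₁ v₂ t ⟩
    0r                                              ∎
    where
    open ≡-Reasoning
    F : ℝ → ℝ → ℝ
    F x y = (v₁ - u₁) * (y - u₂) - (v₂ - u₂) * (x - u₁)

module UnitCircleGeometry (R : RealField) where
  open RealFieldProperties R
  open Complex R
  open Plane R using (Point)
  open IntegerCoefficients ℂ-commutativeRing using (solve; _:+_; _:*_; _:-_; :-_; _:=_; con)
  open ≡-Reasoning

  *ᶜ-cancelˡ : ∀ {z u v} → OnUnitCircle z → z *ᶜ u ≡ z *ᶜ v → u ≡ v
  *ᶜ-cancelˡ {z} {u} {v} ∣z∣≡1 zu≡zv = begin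
    u                        ≡⟨ *ᶜ-identityˡ u ⟨
    1ᶜ *ᶜ u                  ≡⟨ cong (_*ᶜ u) (OnUnitCircle⇒*ᶜ-conj ∣z∣≡1) ⟨
    (z *ᶜ conj z) *ᶜ u       ≡⟨ solve 3 (λ z z̄ u → (z :* z̄) :* u := z̄ :* (z :* u)) refl z (conj z) u ⟩
    conj z *ᶜ (z *ᶜ u)       ≡⟨ cong (conj z *ᶜ_) zu≡zv ⟩
    conj z *ᶜ (z *ᶜ v)       ≡⟨ solve 3 (λ z z̄ v → z̄ :* (z :* v) := (z :* z̄) :* v) refl z (conj z) v ⟩
    (z *ᶜ conj z) *ᶜ v       ≡⟨ cong (_*ᶜ v) (OnUnitCircle⇒*ᶜ-conj ∣z∣≡1) ⟩
    1ᶜ *ᶜ v                  ≡⟨ *ᶜ-identityˡ v ⟩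
    v                        ∎

  self-conj⇒im≡0 : ∀ {w} → conj w ≡ w → im w ≡ 0r
  self-conj⇒im≡0 {w} w̄≡w = x+x≡0⇒x≡0 (trans (cong (λ v → im w + v) (sym (cong im w̄≡w))) (-‿inverseʳ (im w)))

  im≡0⇒self-conj : ∀ {w} → im w ≡ 0r → conj w ≡ w
  im≡0⇒self-conj {w} im≡0 = ℂ-ext refl (trans (cong -_ im≡0) (trans -0#≈0# (sym im≡0)))

  -- On the unit circle conj x = x⁻¹, so conj (y - x) = (x - y) / (x y).
  chord-conj : ∀ {x y} → OnUnitCircle x → OnUnitCircle y → conj (y -ᶜ x) ≡ -ᶜ (conj (x *ᶜ y) *ᶜ (y -ᶜ x))
  chord-conj {x} {y} ∣x∣≡1 ∣y∣≡1 = begin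
    conj (y -ᶜ x)                                        ≡⟨ conj-+ y (-ᶜ x) ⟩
    conj y -ᶜ conj x                                      ≡⟨ cong₂ _-ᶜ_ (*ᶜ-identityˡ (conj y)) (*ᶜ-identityˡ (conj x)) ⟨
    1ᶜ *ᶜ conj y -ᶜ 1ᶜ *ᶜ conj x                          ≡⟨ cong₂ (λ p q → p *ᶜ conj y -ᶜ q *ᶜ conj x)
                                                               (OnUnitCircle⇒*ᶜ-conj ∣x∣≡1) (OnUnitCircle⇒*ᶜ-conj ∣y∣≡1) ⟨
    (x *ᶜ conj x) *ᶜ conj y -ᶜ (y *ᶜ conj y) *ᶜ conj x    ≡⟨ solve 4 (λ x y x̄ ȳ → (x :* x̄) :* ȳ :- (y :* ȳ) :* x̄
                                                                          := :- ((x̄ :* ȳ) :* (y :- x))) refl x y (conj x) (conj y) ⟩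
    -ᶜ ((conj x *ᶜ conj y) *ᶜ (y -ᶜ x))                  ≡⟨ cong (λ c → -ᶜ (c *ᶜ (y -ᶜ x))) (conj-* x y) ⟨
    -ᶜ (conj (x *ᶜ y) *ᶜ (y -ᶜ x))                        ∎

  chords-parallel : ∀ {x y x′ y′} → OnUnitCircle x → OnUnitCircle y → OnUnitCircle x′ → OnUnitCircle y′ →
                    x *ᶜ y ≡ x′ *ᶜ y′ → im (conj (y -ᶜ x) *ᶜ (y′ -ᶜ x′)) ≡ 0r
  chords-parallel {x} {y} {x′} {y′} ∣x∣≡1 ∣y∣≡1 ∣x′∣≡1 ∣y′∣≡1 xy≡x′y′ = self-conj⇒im≡0 (begin
    conj (conj d *ᶜ d′)             ≡⟨ conj-* (conj d) d′ ⟩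
    conj (conj d) *ᶜ conj d′        ≡⟨ cong₂ _*ᶜ_ (conj-involutive d) (chord-conj ∣x′∣≡1 ∣y′∣≡1) ⟩
    d *ᶜ -ᶜ (conj (x′ *ᶜ y′) *ᶜ d′)  ≡⟨ cong (λ p → d *ᶜ -ᶜ (conj p *ᶜ d′)) xy≡x′y′ ⟨
    d *ᶜ -ᶜ (ω *ᶜ d′)                ≡⟨ solve 3 (λ d d′ ω → d :* (:- (ω :* d′)) := (:- (ω :* d)) :* d′) refl d d′ ω ⟩
    -ᶜ (ω *ᶜ d) *ᶜ d′                ≡⟨ cong (_*ᶜ d′) (chord-conj ∣x∣≡1 ∣y∣≡1) ⟨
    conj d *ᶜ d′                    ∎)
    where
    d d′ ω : Point
    d = y -ᶜ x
    d′ = y′ -ᶜ x′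
    ω = conj (x *ᶜ y)

  -ᶜ≡0ᶜ⇒≡ : ∀ {z w} → z -ᶜ w ≡ 0ᶜ → z ≡ w
  -ᶜ≡0ᶜ⇒≡ {z} {w} z-w≡0 = begin
    z                ≡⟨ solve 2 (λ z w → z := (z :- w) :+ w) refl z w ⟩
    (z -ᶜ w) +ᶜ w    ≡⟨ cong (_+ᶜ w) z-w≡0 ⟩
    0ᶜ +ᶜ w          ≡⟨ +ᶜ-identityˡ w ⟩
    w                ∎

  conj-injective : ∀ {z w} → conj z ≡ conj w → z ≡ w
  conj-injective {z} {w} z̄≡w̄ = trans (sym (conj-involutive z)) (trans (cong conj z̄≡w̄) (conj-involutive w))

  -- If conj (q - p) (r - p) is real then, by chord-conj applied to both chords,
  -- (conj (p q) - conj (p r)) (q - p) (r - p) = 0.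
  circle-collinear : ∀ {p q r} → OnUnitCircle p → OnUnitCircle q → OnUnitCircle r →
                     im (conj (q -ᶜ p) *ᶜ (r -ᶜ p)) ≡ 0r → p ≡ q ⊎ q ≡ r ⊎ r ≡ p
  circle-collinear {p} {q} {r} ∣p∣≡1 ∣q∣≡1 ∣r∣≡1 im≡0 = conclude (*ᶜ-zero-product vanishing)
    where
    d₁ d₂ ω₁ ω₂ : Point
    d₁ = q -ᶜ p
    d₂ = r -ᶜ p
    ω₁ = conj (p *ᶜ q)
    ω₂ = conj (p *ᶜ r)
    real : d₁ *ᶜ conj d₂ ≡ conj d₁ *ᶜ d₂
    real = begin
      d₁ *ᶜ conj d₂               ≡⟨ cong (_*ᶜ conj d₂) (conj-involutive d₁) ⟨
      conj (conj d₁) *ᶜ conj d₂   ≡⟨ conj-* (conj d₁) d₂ ⟨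
      conj (conj d₁ *ᶜ d₂)        ≡⟨ im≡0⇒self-conj im≡0 ⟩
      conj d₁ *ᶜ d₂               ∎
    vanishing : (ω₁ -ᶜ ω₂) *ᶜ (d₁ *ᶜ d₂) ≡ 0ᶜ
    vanishing = begin
      (ω₁ -ᶜ ω₂) *ᶜ (d₁ *ᶜ d₂)                       ≡⟨ solve 4 (λ ω₁ ω₂ d₁ d₂ → (ω₁ :- ω₂) :* (d₁ :* d₂)
                                                           := d₁ :* (:- (ω₂ :* d₂)) :- (:- (ω₁ :* d₁)) :* d₂) refl ω₁ ω₂ d₁ d₂ ⟩
      d₁ *ᶜ -ᶜ (ω₂ *ᶜ d₂) -ᶜ -ᶜ (ω₁ *ᶜ d₁) *ᶜ d₂    ≡⟨ cong₂ (λ u v → d₁ *ᶜ u -ᶜ v *ᶜ d₂)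
                                                             (chord-conj ∣p∣≡1 ∣r∣≡1) (chord-conj ∣p∣≡1 ∣q∣≡1) ⟨
      d₁ *ᶜ conj d₂ -ᶜ conj d₁ *ᶜ d₂                 ≡⟨ cong (_-ᶜ conj d₁ *ᶜ d₂) real ⟩
      conj d₁ *ᶜ d₂ -ᶜ conj d₁ *ᶜ d₂                 ≡⟨ solve 1 (λ u → u :- u := con (+ 0)) refl (conj d₁ *ᶜ d₂) ⟩
      0ᶜ                                             ∎
    conclude : ω₁ -ᶜ ω₂ ≡ 0ᶜ ⊎ d₁ *ᶜ d₂ ≡ 0ᶜ → p ≡ q ⊎ q ≡ r ⊎ r ≡ p
    conclude (inj₁ ω₁-ω₂≡0) = inj₂ (inj₁ (*ᶜ-cancelˡ ∣p∣≡1 (conj-injective (-ᶜ≡0ᶜ⇒≡ ω₁-ω₂≡0))))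
    conclude (inj₂ d₁d₂≡0) with *ᶜ-zero-product d₁d₂≡0
    ... | inj₁ d₁≡0 = inj₁ (sym (-ᶜ≡0ᶜ⇒≡ d₁≡0))
    ... | inj₂ d₂≡0 = inj₂ (inj₂ (-ᶜ≡0ᶜ⇒≡ d₂≡0))

minimum : ∀ {A : Set} {_<_ : Rel A 0ℓ} → Transitive _<_ → Trichotomous _≡_ _<_ →
          ∀ {m} (f : Fin (ℕ.suc m) → A) → ∃ λ i → ∀ j → ¬ f j < f i
minimum <-trans <-cmp {ℕ.zero} f = Fin.zero , λ { Fin.zero → tri⇒irr <-cmp refl }
minimum {_<_ = _<_} <-trans <-cmp {ℕ.suc m} f = choose (minimum <-trans <-cmp (f ∘ Fin.suc))
  where
  choose : (∃ λ i → ∀ j → ¬ f (Fin.suc j) < f (Fin.suc i)) → ∃ λ i → ∀ j → ¬ f j < f i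
  choose (i , i-min) with <-cmp (f Fin.zero) (f (Fin.suc i))
  ... | tri< f₀<fᵢ _ _ = Fin.zero , λ { Fin.zero → tri⇒irr <-cmp refl ; (Fin.suc j) fⱼ<f₀ → i-min j (<-trans fⱼ<f₀ f₀<fᵢ) }
  ... | tri≈ f₀≮fᵢ _ _ = Fin.suc i , λ { Fin.zero → f₀≮fᵢ ; (Fin.suc j) → i-min j }
  ... | tri> f₀≮fᵢ _ _ = Fin.suc i , λ { Fin.zero → f₀≮fᵢ ; (Fin.suc j) → i-min j }

module LowerBound (R : RealField) where
  open RealFieldProperties R
  open IntegerCoefficients commutativeRing using (solve; _:+_; _:*_; _:-_; :-_; _:=_; con)
  open Plane R

  infix 4 _<ₗ_
  _<ₗ_ : Point → Point → Set
  _<ₗ_ = ×-Lex _≡_ _<_ _<_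

  <ₗ-trans : Transitive _<ₗ_
  <ₗ-trans = ×-transitive {_≈₁_ = _≡_} {_<₁_ = _<_} {_<₂_ = _<_} isEquivalence (resp₂ _<_) <-trans <-trans

  <ₗ-cmp : Trichotomous _≡_ _<ₗ_
  <ₗ-cmp p q with ×-compare {_≈₁_ = _≡_} {_<₁_ = _<_} {_≈₂_ = _≡_} {_<₂_ = _<_} sym <-cmp <-cmp p q
  ... | tri< p<q p≢q q≮p = tri< p<q (p≢q ∘ ≡⇒≡×≡) q≮p
  ... | tri≈ p≮q p≡q q≮p = tri≈ p≮q (≡×≡⇒≡ p≡q) q≮p
  ... | tri> p≮q p≢q q<p = tri> p≮q (p≢q ∘ ≡⇒≡×≡) q<p

  x-of-<ₗ : ∀ {p q} → p <ₗ q → x-of p ≤ x-of q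
  x-of-<ₗ (inj₁ xp<xq)       = inj₁ xp<xq
  x-of-<ₗ (inj₂ (xp≡xq , _)) = inj₂ xp≡xq

  OnSegment-by-ratio : ∀ {P Q S} t → 0r ≤ t → t ≤ 1r → x-of Q - x-of P ≡ t * (x-of S - x-of P) →
                       y-of Q - y-of P ≡ t * (y-of S - y-of P) → OnSegment P S Q
  OnSegment-by-ratio {P} {Q} t 0≤t t≤1 Δx≡ Δy≡ = t , 0≤t , t≤1 , shift (x-of P) (x-of Q) Δx≡ , shift (y-of P) (y-of Q) Δy≡
    where
    shift : ∀ p q {d} → q - p ≡ d → q ≡ p + d
    shift p q refl = solve 2 (λ p q → q := p :+ (q :- p)) refl p q

  parallel-x-between : ∀ {P Q S} → x-of P ≤ x-of Q → x-of Q ≤ x-of S → x-of P < x-of S →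
                       (x-of Q - x-of P) * (y-of S - y-of P) ≡ (y-of Q - y-of P) * (x-of S - x-of P) → OnSegment P S Q
  parallel-x-between {P} xP≤xQ xQ≤xS xP<xS parallel
    with t , 0≤t , t≤1 , Δx≡ , Δy≡ ← ratio (x≤y⇒0≤y-x xP≤xQ) (-‿monoˡ-≤ (x-of P) xQ≤xS) (x<y⇒0<y-x xP<xS) parallel
    = OnSegment-by-ratio t 0≤t t≤1 Δx≡ Δy≡

  -- If P <ₗ Q <ₗ S and Q - P ∥ S - P, then Q - P = t (S - P) with 0 ≤ t ≤ 1; the ratio t
  -- is read off the x-coordinates unless the three points lie on a vertical line.
  between-parallel : ∀ {P Q S} → P <ₗ Q → Q <ₗ S →
                     (x-of Q - x-of P) * (y-of S - y-of P) ≡ (y-of Q - y-of P) * (x-of S - x-of P) → OnSegment P S Q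
  between-parallel (inj₁ xP<xQ) Q<S parallel =
    parallel-x-between (inj₁ xP<xQ) (x-of-<ₗ Q<S) (<-≤-trans xP<xQ (x-of-<ₗ Q<S)) parallel
  between-parallel (inj₂ (xP≡xQ , _)) (inj₁ xQ<xS) parallel =
    parallel-x-between (inj₂ xP≡xQ) (inj₁ xQ<xS) (≤-<-trans (inj₂ xP≡xQ) xQ<xS) parallel
  between-parallel {P} (inj₂ (refl , yP<yQ)) (inj₂ (refl , yQ<yS)) parallel
    with t , 0≤t , t≤1 , Δy≡ , Δx≡ ← ratio (inj₁ (x<y⇒0<y-x yP<yQ)) (-‿monoˡ-≤ (y-of P) (inj₁ yQ<yS))
                                             (x<y⇒0<y-x (<-trans yP<yQ yQ<yS)) (sym parallel)
    = OnSegment-by-ratio t 0≤t t≤1 Δx≡ Δy≡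

  module _ (G : Graph) (D : Drawing G) where
    open Graph G
    open Drawing D

    above-minimum : ∀ {v w} → (∀ u → ¬ pos u <ₗ pos v) → w ≢ v → pos v <ₗ pos w
    above-minimum {v} {w} v-min w≢v with <ₗ-cmp (pos v) (pos w)
    ... | tri< pv<pw _ _ = pv<pw
    ... | tri≈ _ pv≡pw _ = ⊥-elim (distinct w v w≢v (sym pv≡pw))
    ... | tri> _ _ pw<pv = ⊥-elim (v-min w pw<pv)

    -- Otherwise one neighbour of the minimal vertex v lies on the edge from v to the other.
    minimal-vertex-slopes : ∀ {v w₁ w₂} → (∀ u → ¬ pos u <ₗ pos v) → (e₁ : E v w₁) (e₂ : E v w₂) →
                            w₁ ≢ v → w₂ ≢ v → w₁ ≢ w₂ → ¬ SameSlope G D ((v , w₁) , e₁) ((v , w₂) , e₂)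
    minimal-vertex-slopes {v} {w₁} {w₂} v-min e₁ e₂ w₁≢v w₂≢v w₁≢w₂ parallel with <ₗ-cmp (pos w₁) (pos w₂)
    ... | tri< p₁<p₂ _ _ = clear v w₂ e₂ w₁ w₁≢v w₁≢w₂ (between-parallel (above-minimum v-min w₁≢v) p₁<p₂ parallel)
    ... | tri≈ _ p₁≡p₂ _ = distinct w₁ w₂ w₁≢w₂ p₁≡p₂
    ... | tri> _ _ p₂<p₁ = clear v w₁ e₁ w₂ w₂≢v (w₁≢w₂ ∘ sym)
                             (between-parallel (above-minimum v-min w₂≢v) p₂<p₁ (trans (*-comm _ _) (trans (sym parallel) (*-comm _ _))))

  Kₙₙ-atLeastSlopes : ∀ {n} (D : Drawing (KBip (ℕ.suc n) (ℕ.suc n))) → AtLeastSlopes (KBip (ℕ.suc n) (ℕ.suc n)) D (ℕ.suc n)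
  Kₙₙ-atLeastSlopes {n} D = fan (splitAt (ℕ.suc n) (proj₁ lowest)) lowest-minimal
    where
    open Drawing D
    G : Graph
    G = KBip (ℕ.suc n) (ℕ.suc n)
    lowest : ∃ λ i → ∀ j → ¬ pos (splitAt (ℕ.suc n) j) <ₗ pos (splitAt (ℕ.suc n) i)
    lowest = minimum <ₗ-trans <ₗ-cmp (pos ∘ splitAt (ℕ.suc n))
    lowest-minimal : ∀ u → ¬ pos u <ₗ pos (splitAt (ℕ.suc n) (proj₁ lowest))
    lowest-minimal u = subst (λ w → ¬ pos w <ₗ _) (Fin.splitAt-join (ℕ.suc n) (ℕ.suc n) u) (proj₂ lowest (join (ℕ.suc n) (ℕ.suc n) u))
    fan : ∀ v → (∀ u → ¬ pos u <ₗ pos v) → AtLeastSlopes G D (ℕ.suc n)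
    fan (inj₁ i) v-min = (λ j → (inj₁ i , inj₂ j) , tt) ,
      λ a b a≢b → minimal-vertex-slopes G D v-min tt tt (λ ()) (λ ()) (a≢b ∘ inj₂-injective)
    fan (inj₂ i) v-min = (λ j → (inj₂ i , inj₁ j) , tt) ,
      λ a b a≢b → minimal-vertex-slopes G D v-min tt tt (λ ()) (λ ()) (a≢b ∘ inj₁-injective)

module CircleDrawing (R : RealField) (G : Graph) where
  open Complex R
  open UnitCircleGeometry R
  open Plane R
  open Graph G

  module _ (pos : V → Point) (on-circle : ∀ v → OnUnitCircle (pos v))
           (injective : ∀ u v → u ≢ v → pos u ≢ pos v) where

    no-three-collinear : ∀ u v w → u ≢ v → v ≢ w → u ≢ w → ¬ Collinear (pos u) (pos v) (pos w)
    no-three-collinear u v w u≢v v≢w u≢w collinear =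
      coincidence (circle-collinear (on-circle u) (on-circle v) (on-circle w)
                                    (trans (sym (cross≡im-conj-* (pos u) (pos v) (pos w))) collinear))
      where
      coincidence : pos u ≡ pos v ⊎ pos v ≡ pos w ⊎ pos w ≡ pos u → ⊥
      coincidence (inj₁ pu≡pv)        = injective u v u≢v pu≡pv
      coincidence (inj₂ (inj₁ pv≡pw)) = injective v w v≢w pv≡pw
      coincidence (inj₂ (inj₂ pw≡pu)) = injective u w u≢w (sym pw≡pu)

    circleDrawing : (∀ u v → E u v → u ≢ v) → Drawing G
    circleDrawing loopless = record
      { pos = pos
      ; distinct = injective
      ; clear = λ u v uv w w≢u w≢v onSegment →
          no-three-collinear u v w (loopless u v uv) (w≢v ∘ sym) (w≢u ∘ sym) (OnSegment⇒collinear onSegment) }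

    circleDrawing-convex : (loopless : ∀ u v → E u v → u ≢ v) → Convex G (circleDrawing loopless)
    circleDrawing-convex loopless = no-three-collinear , λ u →
      -ᶜ pos u , OnUnitCircle⇒≢0ᶜ (OnUnitCircle-neg (on-circle u)) , λ w → OnUnitCircle-supporting (on-circle u) (on-circle w)

even+odd≡odd-mod : ∀ a b {r q n} → a ℕ.+ b ≡ r ℕ.+ q ℕ.* n →
                   2 ℕ.* a ℕ.+ 0 ℕ.+ (2 ℕ.* b ℕ.+ 1) ≡ 2 ℕ.* r ℕ.+ 1 ℕ.+ q ℕ.* (n ℕ.* 2)
even+odd≡odd-mod a b {r} {q} {n} a+b≡r+qn = begin
  2 ℕ.* a ℕ.+ 0 ℕ.+ (2 ℕ.* b ℕ.+ 1)  ≡⟨ collect a b ⟩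
  2 ℕ.* (a ℕ.+ b) ℕ.+ 1              ≡⟨ cong (λ s → 2 ℕ.* s ℕ.+ 1) a+b≡r+qn ⟩
  2 ℕ.* (r ℕ.+ q ℕ.* n) ℕ.+ 1        ≡⟨ spread r q n ⟩
  2 ℕ.* r ℕ.+ 1 ℕ.+ q ℕ.* (n ℕ.* 2)  ∎
  where
  open ≡-Reasoning
  collect : ∀ a b → 2 ℕ.* a ℕ.+ 0 ℕ.+ (2 ℕ.* b ℕ.+ 1) ≡ 2 ℕ.* (a ℕ.+ b) ℕ.+ 1
  collect = solve-∀
  spread : ∀ r q n → 2 ℕ.* (r ℕ.+ q ℕ.* n) ℕ.+ 1 ≡ 2 ℕ.* r ℕ.+ 1 ℕ.+ q ℕ.* (n ℕ.* 2)
  spread = solve-∀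

module RegularDrawing (R : RealField) where
  open Complex R
  open UnitCircleGeometry R
  open Plane R

  record PrimitiveRootOfUnity (m : ℕ) : Set where
    field
      ζ         : Point
      on-circle : OnUnitCircle ζ
      ζ^m≡1     : ζ ^ m ≡ 1ᶜ
      ζ^d≢1     : ∀ d → 0 ℕ.< d → d ℕ.< m → ζ ^ d ≢ 1ᶜ

  module _ {m} (root : PrimitiveRootOfUnity m) where
    open PrimitiveRootOfUnity root

    ^-distinct : ∀ {a b} → a ℕ.< b → b ℕ.< m → ζ ^ a ≢ ζ ^ b
    ^-distinct {a} {b} a<b b<m ζ^a≡ζ^b =
      ζ^d≢1 (b ℕ.∸ a) (ℕ.m<n⇒0<n∸m a<b) (ℕ.≤-<-trans (ℕ.m∸n≤m b a) b<m) (*ᶜ-cancelˡ (OnUnitCircle-^ on-circle a) (begin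
        ζ ^ a *ᶜ ζ ^ (b ℕ.∸ a)  ≡⟨ ^-homo-* ζ a (b ℕ.∸ a) ⟨
        ζ ^ (a ℕ.+ (b ℕ.∸ a))   ≡⟨ cong (ζ ^_) (ℕ.m+[n∸m]≡n (ℕ.<⇒≤ a<b)) ⟩
        ζ ^ b                   ≡⟨ ζ^a≡ζ^b ⟨
        ζ ^ a                   ≡⟨ *ᶜ-identityʳ (ζ ^ a) ⟨
        ζ ^ a *ᶜ 1ᶜ             ∎))
      where open ≡-Reasoning

    ^-injective : ∀ {a b} → a ℕ.< m → b ℕ.< m → ζ ^ a ≡ ζ ^ b → a ≡ b
    ^-injective {a} {b} a<m b<m ζ^a≡ζ^b with ℕ.<-cmp a b
    ... | tri< a<b _ _ = ⊥-elim (^-distinct a<b b<m ζ^a≡ζ^b)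
    ... | tri≈ _ a≡b _ = a≡b
    ... | tri> _ _ b<a = ⊥-elim (^-distinct b<a a<m (sym ζ^a≡ζ^b))

    ^-periodic : ∀ a q → ζ ^ (a ℕ.+ q ℕ.* m) ≡ ζ ^ a
    ^-periodic a zero    = cong (ζ ^_) (ℕ.+-identityʳ a)
    ^-periodic a (suc q) = begin
      ζ ^ (a ℕ.+ (m ℕ.+ q ℕ.* m))    ≡⟨ cong (ζ ^_) (ℕ.+-comm a (m ℕ.+ q ℕ.* m)) ⟩
      ζ ^ ((m ℕ.+ q ℕ.* m) ℕ.+ a)    ≡⟨ cong (ζ ^_) (ℕ.+-assoc m (q ℕ.* m) a) ⟩
      ζ ^ (m ℕ.+ (q ℕ.* m ℕ.+ a))    ≡⟨ ^-homo-* ζ m (q ℕ.* m ℕ.+ a) ⟩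
      ζ ^ m *ᶜ ζ ^ (q ℕ.* m ℕ.+ a)   ≡⟨ cong₂ _*ᶜ_ ζ^m≡1 (cong (ζ ^_) (ℕ.+-comm (q ℕ.* m) a)) ⟩
      1ᶜ *ᶜ ζ ^ (a ℕ.+ q ℕ.* m)      ≡⟨ *ᶜ-identityˡ _ ⟩
      ζ ^ (a ℕ.+ q ℕ.* m)            ≡⟨ ^-periodic a q ⟩
      ζ ^ a                          ∎
      where open ≡-Reasoning

  module Kₙₙ {n} .{{_ : ℕ.NonZero n}} (root : PrimitiveRootOfUnity (n ℕ.* 2)) where
    open PrimitiveRootOfUnity root

    V : Set
    V = Fin n ⊎ Fin n

    -- The colour classes alternate around the 2n-gon: inj₁ i sits at ζ^(2i), inj₂ j at ζ^(2j+1).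
    slot : V → Fin (n ℕ.* 2)
    slot (inj₁ i) = combine i Fin.zero
    slot (inj₂ j) = combine j (Fin.suc Fin.zero)

    slot-injective : ∀ u v → slot u ≡ slot v → u ≡ v
    slot-injective (inj₁ i) (inj₁ j) eq = cong inj₁ (Fin.combine-injectiveˡ i _ j _ eq)
    slot-injective (inj₁ i) (inj₂ j) eq with () ← Fin.combine-injectiveʳ i _ j _ eq
    slot-injective (inj₂ i) (inj₁ j) eq with () ← Fin.combine-injectiveʳ i _ j _ eq
    slot-injective (inj₂ i) (inj₂ j) eq = cong inj₂ (Fin.combine-injectiveˡ i _ j _ eq)

    position : V → Point
    position v = ζ ^ toℕ (slot v)

    position-injective : ∀ u v → u ≢ v → position u ≢ position v
    position-injective u v u≢v ζ^u≡ζ^v =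
      u≢v (slot-injective u v (Fin.toℕ-injective (^-injective root (Fin.toℕ<n (slot u)) (Fin.toℕ<n (slot v)) ζ^u≡ζ^v)))

    edge-class : Fin n → Fin n → Fin n
    edge-class i j = DivMod.remainder ((toℕ i ℕ.+ toℕ j) divMod n)

    position-product : ∀ i j → position (inj₁ i) *ᶜ position (inj₂ j) ≡ ζ ^ (2 ℕ.* toℕ (edge-class i j) ℕ.+ 1)
    position-product i j = begin
      ζ ^ toℕ (combine i Fin.zero) *ᶜ ζ ^ toℕ (combine j (Fin.suc Fin.zero))
        ≡⟨ cong₂ (λ a b → ζ ^ a *ᶜ ζ ^ b) (Fin.toℕ-combine i Fin.zero) (Fin.toℕ-combine j (Fin.suc Fin.zero)) ⟩
      ζ ^ (2 ℕ.* toℕ i ℕ.+ 0) *ᶜ ζ ^ (2 ℕ.* toℕ j ℕ.+ 1)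
        ≡⟨ ^-homo-* ζ (2 ℕ.* toℕ i ℕ.+ 0) (2 ℕ.* toℕ j ℕ.+ 1) ⟨
      ζ ^ (2 ℕ.* toℕ i ℕ.+ 0 ℕ.+ (2 ℕ.* toℕ j ℕ.+ 1))
        ≡⟨ cong (ζ ^_) (even+odd≡odd-mod (toℕ i) (toℕ j) {toℕ (edge-class i j)} {DivMod.quotient i+j} {n} (DivMod.property i+j)) ⟩
      ζ ^ (2 ℕ.* toℕ (edge-class i j) ℕ.+ 1 ℕ.+ DivMod.quotient i+j ℕ.* (n ℕ.* 2))
        ≡⟨ ^-periodic root (2 ℕ.* toℕ (edge-class i j) ℕ.+ 1) (DivMod.quotient i+j) ⟩
      ζ ^ (2 ℕ.* toℕ (edge-class i j) ℕ.+ 1)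
        ∎
      where
      open ≡-Reasoning
      i+j : DivMod (toℕ i ℕ.+ toℕ j) n
      i+j = (toℕ i ℕ.+ toℕ j) divMod n

    position-on-circle : ∀ v → OnUnitCircle (position v)
    position-on-circle v = OnUnitCircle-^ on-circle (toℕ (slot v))

    loopless : ∀ u v → Graph.E (KBip n n) u v → u ≢ v
    loopless (inj₁ _) (inj₂ _) _ ()
    loopless (inj₂ _) (inj₁ _) _ ()

    open CircleDrawing R (KBip n n)

    regularDrawing : Drawing (KBip n n)
    regularDrawing = circleDrawing position position-on-circle position-injective loopless

    regularDrawing-convex : Convex (KBip n n) regularDrawing
    regularDrawing-convex = circleDrawing-convex position position-on-circle position-injective loopless

    slope-class : Edge (KBip n n) → Fin n
    slope-class ((inj₁ i , inj₂ j) , _) = edge-class i j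
    slope-class ((inj₂ j , inj₁ i) , _) = edge-class i j

    endpoint-product : ∀ (e : Edge (KBip n n)) →
                       position (proj₁ (proj₁ e)) *ᶜ position (proj₂ (proj₁ e)) ≡ ζ ^ (2 ℕ.* toℕ (slope-class e) ℕ.+ 1)
    endpoint-product ((inj₁ i , inj₂ j) , _) = position-product i j
    endpoint-product ((inj₂ j , inj₁ i) , _) = trans (*ᶜ-comm (position (inj₂ j)) (position (inj₁ i))) (position-product i j)

    regularDrawing-slopes : AtMostSlopes (KBip n n) regularDrawing n
    regularDrawing-slopes = slope-class , parallel
      where
      parallel : ∀ e e′ → slope-class e ≡ slope-class e′ → SameSlope (KBip n n) regularDrawing e e′
      parallel e@((u , v) , _) e′@((u′ , v′) , _) same-class =
        im-conj-*≡0⇒parallel (position v -ᶜ position u) (position v′ -ᶜ position u′)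
          (chords-parallel (position-on-circle u) (position-on-circle v) (position-on-circle u′) (position-on-circle v′)
            (trans (endpoint-product e) (trans (cong (λ k → ζ ^ (2 ℕ.* toℕ k ℕ.+ 1)) same-class) (sym (endpoint-product e′)))))

module Analysis (R : RealField) where
  open RealFieldProperties R
  open IntegerCoefficients commutativeRing using (solve; _:+_; _:*_; _:-_; :-_; _:=_; con)

  infix 4 ∣_∣≤_
  ∣_∣≤_ : ℝ → ℝ → Set
  ∣ a ∣≤ M = 0r ≤ M - a × 0r ≤ M + a

  ∣∣≤-resp : ∀ {a a′ M M′} → a ≡ a′ → M ≡ M′ → ∣ a ∣≤ M → ∣ a′ ∣≤ M′
  ∣∣≤-resp refl refl a≤M = a≤M

  ∣∣≤-nonNeg : ∀ {a M} → ∣ a ∣≤ M → 0r ≤ M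
  ∣∣≤-nonNeg {a} {M} (0≤M-a , 0≤M+a) =
    half-nonNeg (subst (0r ≤_) (solve 2 (λ a M → (M :- a) :+ (M :+ a) := M :+ M) refl a M) (+-nonNeg 0≤M-a 0≤M+a))

  ∣∣≤-self : ∀ {d} → 0r ≤ d → ∣ d ∣≤ d
  ∣∣≤-self {d} 0≤d = inj₂ (sym (-‿inverseʳ d)) , +-nonNeg 0≤d 0≤d

  ∣∣≤-weaken : ∀ {a M M′} → M ≤ M′ → ∣ a ∣≤ M → ∣ a ∣≤ M′
  ∣∣≤-weaken {a} {M} {M′} M≤M′ (0≤M-a , 0≤M+a) =
    subst (0r ≤_) (solve 3 (λ a M M′ → (M′ :- M) :+ (M :- a) := M′ :- a) refl a M M′) (+-nonNeg (x≤y⇒0≤y-x M≤M′) 0≤M-a) ,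
    subst (0r ≤_) (solve 3 (λ a M M′ → (M′ :- M) :+ (M :+ a) := M′ :+ a) refl a M M′) (+-nonNeg (x≤y⇒0≤y-x M≤M′) 0≤M+a)

  ∣∣≤-neg : ∀ {a M} → ∣ a ∣≤ M → ∣ - a ∣≤ M
  ∣∣≤-neg {a} {M} (0≤M-a , 0≤M+a) =
    subst (0r ≤_) (solve 2 (λ a M → M :+ a := M :- (:- a)) refl a M) 0≤M+a ,
    subst (0r ≤_) (solve 2 (λ a M → M :- a := M :+ (:- a)) refl a M) 0≤M-a

  ∣∣≤-+ : ∀ {a b M N} → ∣ a ∣≤ M → ∣ b ∣≤ N → ∣ a + b ∣≤ M + N
  ∣∣≤-+ {a} {b} {M} {N} (0≤M-a , 0≤M+a) (0≤N-b , 0≤N+b) =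
    subst (0r ≤_) (solve 4 (λ a b M N → (M :- a) :+ (N :- b) := (M :+ N) :- (a :+ b)) refl a b M N) (+-nonNeg 0≤M-a 0≤N-b) ,
    subst (0r ≤_) (solve 4 (λ a b M N → (M :+ a) :+ (N :+ b) := (M :+ N) :+ (a :+ b)) refl a b M N) (+-nonNeg 0≤M+a 0≤N+b)

  -- (M ∓ a)(N ± b) + (M ± a)(N ∓ b) = 2 (M N ∓ a b)
  ∣∣≤-* : ∀ {a b M N} → ∣ a ∣≤ M → ∣ b ∣≤ N → ∣ a * b ∣≤ M * N
  ∣∣≤-* {a} {b} {M} {N} (0≤M-a , 0≤M+a) (0≤N-b , 0≤N+b) =
    half-nonNeg (subst (0r ≤_) (solve 4 (λ a b M N → (M :- a) :* (N :+ b) :+ (M :+ a) :* (N :- b) := (M :* N :- a :* b) :+ (M :* N :- a :* b)) refl a b M N)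
                  (+-nonNeg (*-nonNeg 0≤M-a 0≤N+b) (*-nonNeg 0≤M+a 0≤N-b))) ,
    half-nonNeg (subst (0r ≤_) (solve 4 (λ a b M N → (M :+ a) :* (N :+ b) :+ (M :- a) :* (N :- b) := (M :* N :+ a :* b) :+ (M :* N :+ a :* b)) refl a b M N)
                  (+-nonNeg (*-nonNeg 0≤M+a 0≤N+b) (*-nonNeg 0≤M-a 0≤N-b)))

  2r : ℝ
  2r = 1r + 1r

  0<2 : 0r < 2r
  0<2 = +-pos 0<1 0<1

  1<2 : 1r < 2r
  1<2 = subst (_< 2r) (+-identityˡ 1r) (+-mono-< 1r 0<1)

  In[0,2] : ℝ → Set
  In[0,2] x = 0r ≤ x × x ≤ 2r

  0∈[0,2] : In[0,2] 0r
  0∈[0,2] = inj₂ refl , inj₁ 0<2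

  -- Bounded and Lipschitz on [0, 2]; polynomials are tame, and tame functions keep their sign near a point.
  record Tame (f : ℝ → ℝ) : Set where
    field
      bound lip  : ℝ
      lip-nonNeg : 0r ≤ lip
      bounded    : ∀ {x} → In[0,2] x → ∣ f x ∣≤ bound
      lipschitz  : ∀ {x y} → In[0,2] x → In[0,2] y → x ≤ y → ∣ f y - f x ∣≤ lip * (y - x)

  tame-const : ∀ {c M} → ∣ c ∣≤ M → Tame (λ _ → c)
  tame-const {c} c≤M = record
    { bound = _ ; lip = 0r ; lip-nonNeg = inj₂ refl ; bounded = λ _ → c≤M
    ; lipschitz = λ {x} {y} _ _ _ → ∣∣≤-resp (sym (-‿inverseʳ c)) (sym (zeroˡ (y - x))) (∣∣≤-self (inj₂ refl)) }

  tame-id : Tame (λ x → x)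
  tame-id = record
    { bound = 2r ; lip = 1r ; lip-nonNeg = inj₁ 0<1
    ; bounded = λ { (0≤x , x≤2) → x≤y⇒0≤y-x x≤2 , +-nonNeg (inj₁ 0<2) 0≤x }
    ; lipschitz = λ {x} {y} _ _ x≤y → ∣∣≤-resp refl (sym (*-identityˡ (y - x))) (∣∣≤-self (x≤y⇒0≤y-x x≤y)) }

  tame-neg : ∀ {f} → Tame f → Tame (λ x → - f x)
  tame-neg {f} tf = record
    { bound = bound ; lip = lip ; lip-nonNeg = lip-nonNeg
    ; bounded = λ x∈I → ∣∣≤-neg (bounded x∈I)
    ; lipschitz = λ {x} {y} x∈I y∈I x≤y →
        ∣∣≤-resp (solve 2 (λ a b → :- (a :- b) := :- a :- :- b) refl (f y) (f x)) refl (∣∣≤-neg (lipschitz x∈I y∈I x≤y)) }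
    where open Tame tf

  tame-+ : ∀ {f g} → Tame f → Tame g → Tame (λ x → f x + g x)
  tame-+ {f} {g} tf tg = record
    { bound = F.bound + G.bound ; lip = F.lip + G.lip ; lip-nonNeg = +-nonNeg F.lip-nonNeg G.lip-nonNeg
    ; bounded = λ x∈I → ∣∣≤-+ (F.bounded x∈I) (G.bounded x∈I)
    ; lipschitz = λ {x} {y} x∈I y∈I x≤y →
        ∣∣≤-resp (solve 4 (λ a b c d → (a :- b) :+ (c :- d) := (a :+ c) :- (b :+ d)) refl (f y) (f x) (g y) (g x))
                 (solve 3 (λ L K d → L :* d :+ K :* d := (L :+ K) :* d) refl F.lip G.lip (y - x))
                 (∣∣≤-+ (F.lipschitz x∈I y∈I x≤y) (G.lipschitz x∈I y∈I x≤y)) }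
    where
    module F = Tame tf
    module G = Tame tg

  -- f y g y - f x g x = f y (g y - g x) + g x (f y - f x)
  tame-* : ∀ {f g} → Tame f → Tame g → Tame (λ x → f x * g x)
  tame-* {f} {g} tf tg = record
    { bound = F.bound * G.bound ; lip = F.bound * G.lip + G.bound * F.lip
    ; lip-nonNeg = +-nonNeg (*-nonNeg (∣∣≤-nonNeg (F.bounded 0∈[0,2])) G.lip-nonNeg) (*-nonNeg (∣∣≤-nonNeg (G.bounded 0∈[0,2])) F.lip-nonNeg)
    ; bounded = λ x∈I → ∣∣≤-* (F.bounded x∈I) (G.bounded x∈I)
    ; lipschitz = λ {x} {y} x∈I y∈I x≤y →
        ∣∣≤-resp (solve 4 (λ fx fy gx gy → fy :* (gy :- gx) :+ gx :* (fy :- fx) := fy :* gy :- fx :* gx) refl (f x) (f y) (g x) (g y))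
                 (solve 5 (λ M N L K d → M :* (K :* d) :+ N :* (L :* d) := (M :* K :+ N :* L) :* d) refl F.bound G.bound F.lip G.lip (y - x))
                 (∣∣≤-+ (∣∣≤-* (F.bounded y∈I) (G.lipschitz x∈I y∈I x≤y)) (∣∣≤-* (G.bounded x∈I) (F.lipschitz x∈I y∈I x≤y))) }
    where
    module F = Tame tf
    module G = Tame tg

  -- δ ≤ 1 keeps t + δ inside [0, 2] when t ≤ 1.
  HoldsNear : (ℝ → Set) → ℝ → Set
  HoldsNear P x₀ = ∃ λ δ → 0r < δ × δ ≤ 1r × ∀ {y} → In[0,2] y → ∣ y - x₀ ∣≤ δ → P y

  holdsNear-map : ∀ {P Q : ℝ → Set} {x₀} → (∀ {y} → P y → Q y) → HoldsNear P x₀ → HoldsNear Q x₀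
  holdsNear-map P⇒Q (δ , 0<δ , δ≤1 , near) = δ , 0<δ , δ≤1 , λ y∈I y≈x₀ → P⇒Q (near y∈I y≈x₀)

  holdsNear-× : ∀ {P Q : ℝ → Set} {x₀} → HoldsNear P x₀ → HoldsNear Q x₀ → HoldsNear (λ y → P y × Q y) x₀
  holdsNear-× {x₀ = x₀} (δ₁ , 0<δ₁ , δ₁≤1 , P-near) (δ₂ , 0<δ₂ , δ₂≤1 , Q-near) with <-cmp δ₁ δ₂
  ... | tri< δ₁<δ₂ _ _ = δ₁ , 0<δ₁ , δ₁≤1 , λ y∈I y≈x₀ →
                           P-near y∈I y≈x₀ , Q-near y∈I (∣∣≤-weaken (inj₁ δ₁<δ₂) y≈x₀)
  ... | tri≈ _ refl _  = δ₁ , 0<δ₁ , δ₁≤1 , λ y∈I y≈x₀ → P-near y∈I y≈x₀ , Q-near y∈I y≈x₀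
  ... | tri> _ _ δ₂<δ₁ = δ₂ , 0<δ₂ , δ₂≤1 , λ y∈I y≈x₀ →
                           P-near y∈I (∣∣≤-weaken (inj₁ δ₂<δ₁) y≈x₀) , Q-near y∈I y≈x₀

  holdsNear-∀ : ∀ {K} {P : Fin K → ℝ → Set} {x₀} → (∀ i → HoldsNear (P i) x₀) → HoldsNear (λ y → ∀ i → P i y) x₀
  holdsNear-∀ {ℕ.zero}  _    = 1r , 0<1 , inj₂ refl , λ _ _ ()
  holdsNear-∀ {ℕ.suc K} near = holdsNear-map (λ { (p₀ , p) Fin.zero → p₀ ; (p₀ , p) (Fin.suc i) → p i })
                                             (holdsNear-× (near Fin.zero) (holdsNear-∀ (near ∘ Fin.suc)))

  -- δ = v / (L + v + 1)
  persistence-radius : ∀ {L v} → 0r ≤ L → 0r < v → ∃ λ δ → 0r < δ × δ ≤ 1r × 0r < v - L * δ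
  persistence-radius {L} {v} 0≤L 0<v = choose (inverse K (<⇒≢ 0<K ∘ sym))
    where
    open ≡-Reasoning
    K : ℝ
    K = L + v + 1r
    0<K : 0r < K
    0<K = +-pos (subst (0r <_) (+-comm v L) (+-pos-nonNeg 0<v 0≤L)) 0<1
    choose : (∃ λ k → K * k ≡ 1r) → ∃ λ δ → 0r < δ × δ ≤ 1r × 0r < v - L * δ
    choose (k , Kk≡1) = v * k , *-pos 0<v 0<k , δ≤1 , subst (0r <_) v-Lδ (*-pos (*-pos 0<v (+-pos 0<v 0<1)) 0<k)
      where
      0<k : 0r < k
      0<k = inverse-pos 0<K Kk≡1
      1-δ : (L + 1r) * k ≡ 1r - v * k
      1-δ = begin
        (L + 1r) * k     ≡⟨ solve 3 (λ L v k → (L :+ con (+ 1)) :* k := (L :+ v :+ con (+ 1)) :* k :- v :* k) refl L v k ⟩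
        K * k - v * k    ≡⟨ cong (_- v * k) Kk≡1 ⟩
        1r - v * k       ∎
      δ≤1 : v * k ≤ 1r
      δ≤1 = 0≤y-x⇒x≤y (subst (0r ≤_) 1-δ (*-nonNeg (+-nonNeg 0≤L (inj₁ 0<1)) (inj₁ 0<k)))
      v-Lδ : v * (v + 1r) * k ≡ v - L * (v * k)
      v-Lδ = begin
        v * (v + 1r) * k            ≡⟨ solve 3 (λ L v k → v :* (v :+ con (+ 1)) :* k := v :* ((L :+ v :+ con (+ 1)) :* k) :- L :* (v :* k)) refl L v k ⟩
        v * (K * k) - L * (v * k)   ≡⟨ cong (λ u → v * u - L * (v * k)) Kk≡1 ⟩
        v * 1r - L * (v * k)        ≡⟨ cong (_- L * (v * k)) (*-identityʳ v) ⟩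
        v - L * (v * k)             ∎

  -- f y ≥ f x₀ - L ∣ y - x₀ ∣ ≥ f x₀ - L δ > 0.
  tame-positive-near : ∀ {f x₀} → Tame f → In[0,2] x₀ → 0r < f x₀ → HoldsNear (λ y → 0r < f y) x₀
  tame-positive-near {f} {x₀} tf x₀∈I 0<fx₀ = around (persistence-radius lip-nonNeg 0<fx₀)
    where
    open Tame tf
    around : (∃ λ δ → 0r < δ × δ ≤ 1r × 0r < f x₀ - lip * δ) → HoldsNear (λ y → 0r < f y) x₀
    around (δ , 0<δ , δ≤1 , margin) = δ , 0<δ , δ≤1 , near
      where
      near : ∀ {y} → In[0,2] y → ∣ y - x₀ ∣≤ δ → 0r < f y
      near {y} y∈I (0≤δ-Δ , 0≤δ+Δ) = split (<-cmp y x₀)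
        where
        below : y ≤ x₀ → 0r < f y
        below y≤x₀ = subst (0r <_)
          (solve 6 (λ L d fy fx y x → (fx :- L :* d) :+ ((L :* (x :- y) :- (fx :- fy)) :+ L :* (d :+ (y :- x))) := fy) refl lip δ (f y) (f x₀) y x₀)
          (+-pos-nonNeg margin (+-nonNeg (proj₁ (lipschitz y∈I x₀∈I y≤x₀)) (*-nonNeg lip-nonNeg 0≤δ+Δ)))
        above : x₀ ≤ y → 0r < f y
        above x₀≤y = subst (0r <_)
          (solve 6 (λ L d fy fx y x → (fx :- L :* d) :+ ((L :* (y :- x) :+ (fy :- fx)) :+ L :* (d :- (y :- x))) := fy) refl lip δ (f y) (f x₀) y x₀)
          (+-pos-nonNeg margin (+-nonNeg (proj₂ (lipschitz x₀∈I y∈I x₀≤y)) (*-nonNeg lip-nonNeg 0≤δ-Δ)))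
        split : Tri (y < x₀) (y ≡ x₀) (x₀ < y) → 0r < f y
        split (tri< y<x₀ _ _) = below (inj₁ y<x₀)
        split (tri≈ _ y≡x₀ _) = below (inj₂ y≡x₀)
        split (tri> _ _ x₀<y) = above (inj₁ x₀<y)

  tame-negative-near : ∀ {f x₀} → Tame f → In[0,2] x₀ → f x₀ < 0r → HoldsNear (λ y → f y < 0r) x₀
  tame-negative-near tf x₀∈I fx₀<0 = holdsNear-map 0<-x⇒x<0 (tame-positive-near (tame-neg tf) x₀∈I (x<0⇒0<-x fx₀<0))

  -- t is the supremum of { t : every g i is positive on [0, t] }: below t all g i are positive,
  -- a negative value at t would persist slightly to the left of t, and if all were positive at t
  -- they would stay positive slightly to the right of t.
  module FirstZero {K} (g : Fin K → ℝ → ℝ) (tame : ∀ i → Tame (g i)) (g-pos-at-0 : ∀ i → 0r < g i 0r)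
                   (i₁ : Fin K) (gi₁1≤0 : g i₁ 1r ≤ 0r) where
    PositiveUpTo : ℝ → Set
    PositiveUpTo t = 0r ≤ t × (∀ {s} → 0r ≤ s → s ≤ t → ∀ i → 0r < g i s)

    positiveUpTo-0 : PositiveUpTo 0r
    positiveUpTo-0 = inj₂ refl , λ {s} 0≤s s≤0 i → subst (λ s → 0r < g i s) (≤-antisym 0≤s s≤0) (g-pos-at-0 i)

    positiveUpTo⇒≤1 : ∀ t → PositiveUpTo t → t ≤ 1r
    positiveUpTo⇒≤1 t (_ , pos) = ≮⇒≥ (λ 1<t → ≤⇒≯ gi₁1≤0 (pos (inj₁ 0<1) (inj₁ 1<t) i₁))

    supremum : ∃ λ t → (∀ u → PositiveUpTo u → u ≤ t) × (∀ b → (∀ u → PositiveUpTo u → u ≤ b) → t ≤ b)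
    supremum = complete PositiveUpTo (0r , positiveUpTo-0) (1r , positiveUpTo⇒≤1)

    t : ℝ
    t = proj₁ supremum

    0≤t : 0r ≤ t
    0≤t = proj₁ (proj₂ supremum) 0r positiveUpTo-0

    t≤1 : t ≤ 1r
    t≤1 = proj₂ (proj₂ supremum) 1r positiveUpTo⇒≤1

    t∈[0,2] : In[0,2] t
    t∈[0,2] = 0≤t , ≤-trans t≤1 (inj₁ 1<2)

    positive-below-t : ∀ {s} → 0r ≤ s → s < t → ∀ i → 0r < g i s
    positive-below-t {s} 0≤s s<t i = <-stable λ gis≯0 →
      ≤⇒≯ (proj₂ (proj₂ supremum) s (λ u (_ , pos) → ≮⇒≥ (λ s<u → gis≯0 (pos 0≤s (inj₁ s<u) i)))) s<t

    nonNeg-at-t : ∀ i → 0r ≤ g i t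
    nonNeg-at-t i = ≮⇒≥ λ git<0 → escape git<0 0≤t (tame-negative-near (tame i) t∈[0,2] git<0)
      where
      escape : g i t < 0r → 0r ≤ t → HoldsNear (λ y → g i y < 0r) t → ⊥
      escape git<0 (inj₂ 0≡t) _ = <-asym (g-pos-at-0 i) (subst (λ s → g i s < 0r) (sym 0≡t) git<0)
      escape git<0 (inj₁ 0<t) (δ , 0<δ , _ , negative) with ε , 0<ε , ε≤δ , ε≤t ← min-pos 0<δ 0<t =
        <-asym (positive-below-t 0≤y y<t i) (negative (0≤y , ≤-trans (inj₁ y<t) (proj₂ t∈[0,2])) y≈t)
        where
        y : ℝ
        y = t - ε
        0≤y : 0r ≤ y
        0≤y = x≤y⇒0≤y-x ε≤t
        y<t : y < t
        y<t = 0<y-x⇒x<y (subst (0r <_) (solve 2 (λ t ε → ε := t :- (t :- ε)) refl t ε) 0<ε)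
        y≈t : ∣ y - t ∣≤ δ
        y≈t = subst (0r ≤_) (solve 3 (λ δ ε t → δ :+ ε := δ :- ((t :- ε) :- t)) refl δ ε t) (+-nonNeg (inj₁ 0<δ) (inj₁ 0<ε)) ,
              subst (0r ≤_) (solve 3 (λ δ ε t → δ :- ε := δ :+ ((t :- ε) :- t)) refl δ ε t) (x≤y⇒0≤y-x ε≤δ)

    all-positive-at-t⇒⊥ : (∀ i → 0r < g i t) → ⊥
    all-positive-at-t⇒⊥ pos = extend (holdsNear-∀ (λ i → tame-positive-near (tame i) t∈[0,2] (pos i)))
      where
      extend : HoldsNear (λ y → ∀ i → 0r < g i y) t → ⊥
      extend (δ , 0<δ , δ≤1 , near) = ≤⇒≯ (proj₁ (proj₂ supremum) (t + δ) positiveUpTo-t+δ) t<t+δ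
        where
        t<t+δ : t < t + δ
        t<t+δ = 0<y-x⇒x<y (subst (0r <_) (solve 2 (λ t δ → δ := (t :+ δ) :- t) refl t δ) 0<δ)
        beyond : ∀ {s} → 0r ≤ s → s ≤ t + δ → Tri (s < t) (s ≡ t) (t < s) → ∀ i → 0r < g i s
        beyond 0≤s _ (tri< s<t _ _) = positive-below-t 0≤s s<t
        beyond _ _ (tri≈ _ refl _) = pos
        beyond {s} 0≤s s≤t+δ (tri> _ _ t<s) = near (0≤s , ≤-trans s≤t+δ (+-mono-≤ t≤1 δ≤1))
          (subst (0r ≤_) (solve 3 (λ t δ s → (t :+ δ) :- s := δ :- (s :- t)) refl t δ s) (x≤y⇒0≤y-x s≤t+δ) ,
           +-nonNeg (inj₁ 0<δ) (inj₁ (x<y⇒0<y-x t<s)))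
        positiveUpTo-t+δ : PositiveUpTo (t + δ)
        positiveUpTo-t+δ = +-nonNeg 0≤t (inj₁ 0<δ) , λ {s} 0≤s s≤t+δ → beyond 0≤s s≤t+δ (<-cmp s t)

    zero-at-t : ∃ λ i → g i t ≡ 0r
    zero-at-t with Fin.any? (λ i → g i t ≟ 0r)
    ... | yes found = found
    ... | no none = ⊥-elim (all-positive-at-t⇒⊥ (λ i → ≤∧≢⇒< (nonNeg-at-t i) (λ 0≡git → none (i , sym 0≡git))))

    0<t : 0r < t
    0<t = ≤∧≢⇒< 0≤t λ 0≡t → <⇒≢ (subst (λ s → 0r < g (proj₁ zero-at-t) s) 0≡t (g-pos-at-0 (proj₁ zero-at-t))) (sym (proj₂ zero-at-t))

  first-zero : ∀ {K} (g : Fin K → ℝ → ℝ) → (∀ i → Tame (g i)) → (∀ i → 0r < g i 0r) → (∃ λ i → g i 1r ≤ 0r) →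
               ∃ λ t → 0r < t × t ≤ 1r × (∀ i → 0r ≤ g i t) × (∃ λ i → g i t ≡ 0r)
  first-zero g tame g-pos-at-0 (i₁ , gi₁1≤0) = t , 0<t , t≤1 , nonNeg-at-t , zero-at-t
    where open FirstZero g tame g-pos-at-0 i₁ gi₁1≤0

module RootConstruction (R : RealField) where
  open RealFieldProperties R
  open IntegerCoefficients commutativeRing using (solve; _:+_; _:*_; _:-_; :-_; _:=_; con)
  open Complex R
  open Analysis R
  open Plane R using (Point)

  -- (1 + i t) ^ m = A m t + i t B m t
  A B : ℕ → ℝ → ℝ
  A zero    t = 1r
  A (suc m) t = A m t - t * t * B m t
  B zero    t = 0r
  B (suc m) t = A m t + B m t

  tame-AB : ∀ m → Tame (A m) × Tame (B m)
  tame-AB zero    = tame-const (∣∣≤-self (inj₁ 0<1)) , tame-const (∣∣≤-self (inj₂ refl))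
  tame-AB (suc m) = tame-+ tame-A (tame-neg (tame-* (tame-* tame-id tame-id) tame-B)) , tame-+ tame-A tame-B
    where
    tame-A : Tame (A m)
    tame-A = proj₁ (tame-AB m)
    tame-B : Tame (B m)
    tame-B = proj₂ (tame-AB m)

  1+it^m : ∀ t m → (1r , t) ^ m ≡ (A m t , t * B m t)
  1+it^m t zero    = ℂ-ext refl (sym (zeroʳ t))
  1+it^m t (suc m) = begin
    (1r , t) *ᶜ (1r , t) ^ m           ≡⟨ cong ((1r , t) *ᶜ_) (1+it^m t m) ⟩
    (1r , t) *ᶜ (A m t , t * B m t)    ≡⟨ ℂ-ext (solve 3 (λ t a b → con (+ 1) :* a :- t :* (t :* b) := a :- t :* t :* b) refl t (A m t) (B m t))
                                                (solve 3 (λ t a b → con (+ 1) :* (t :* b) :+ t :* a := t :* (a :+ b)) refl t (A m t) (B m t)) ⟩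
    (A (suc m) t , t * B (suc m) t)    ∎
    where open ≡-Reasoning

  A-at-0 : ∀ m → A m 0r ≡ 1r
  A-at-0 zero    = refl
  A-at-0 (suc m) = trans (cong (_- 0r * 0r * B m 0r) (A-at-0 m)) (solve 1 (λ b → con (+ 1) :- con (+ 0) :* con (+ 0) :* b := con (+ 1)) refl (B m 0r))

  B-suc-at-0-pos : ∀ m → 0r < B (suc m) 0r
  B-suc-at-0-pos zero    = +-pos-nonNeg 0<1 (inj₂ refl)
  B-suc-at-0-pos (suc m) = subst (λ a → 0r < a + B (suc m) 0r) (sym (A-at-0 (suc m))) (+-pos 0<1 (B-suc-at-0-pos m))

  B-2 : ∀ t → B 2 t ≡ 2r
  B-2 = solve 1 (λ t → (con (+ 1) :- t :* t :* con (+ 0)) :+ (con (+ 1) :+ con (+ 0)) := con (+ 2)) refl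

  -- (1 + i) ^ 4 = -4
  B-4-at-1 : B 4 1r ≡ 0r
  B-4-at-1 = solve 0 (let a₁ = con (+ 1) :- con (+ 1) :* con (+ 1) :* con (+ 0)
                          b₁ = con (+ 1) :+ con (+ 0)
                          a₂ = a₁ :- con (+ 1) :* con (+ 1) :* b₁
                          b₂ = a₁ :+ b₁
                          a₃ = a₂ :- con (+ 1) :* con (+ 1) :* b₂
                          b₃ = a₂ :+ b₂
                      in a₃ :+ b₃ := con (+ 0)) refl

  open import Algebra.Properties.Semiring.Exp (CommutativeRing.semiring commutativeRing) using () renaming (_^_ to _^ℝ_)
  open import Algebra.Properties.CommutativeSemiring.Exp (CommutativeRing.commutativeSemiring ℂ-commutativeRing) using (^-distrib-*)

  ^ℝ-pos : ∀ {a} → 0r < a → ∀ k → 0r < a ^ℝ k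
  ^ℝ-pos 0<a zero    = 0<1
  ^ℝ-pos 0<a (suc k) = *-pos 0<a (^ℝ-pos 0<a k)

  ofℝ-^ : ∀ a k → ofℝ a ^ k ≡ ofℝ (a ^ℝ k)
  ofℝ-^ a zero    = refl
  ofℝ-^ a (suc k) = trans (cong (ofℝ a *ᶜ_) (ofℝ-^ a k)) (ofℝ-* a (a ^ℝ k))

  ∣1+it∣²-pos : ∀ t → 0r < ∣ (1r , t) ∣²
  ∣1+it∣²-pos t = +-pos-nonNeg (subst (0r <_) (sym (*-identityˡ 1r)) 0<1) (square-nonNeg t)

  ∣1+it∣²-inverse : ∀ t → ∃ λ c → ∣ (1r , t) ∣² * c ≡ 1r
  ∣1+it∣²-inverse t = inverse ∣ (1r , t) ∣² (<⇒≢ (∣1+it∣²-pos t) ∘ sym)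

  module NormalisedSquare (t : ℝ) where
    w : Point
    w = (1r , t)

    c : ℝ
    c = proj₁ (∣1+it∣²-inverse t)

    z : Point
    z = ofℝ c *ᶜ (w *ᶜ w)

    0<c : 0r < c
    0<c = inverse-pos (∣1+it∣²-pos t) (proj₂ (∣1+it∣²-inverse t))

    z-on-circle : OnUnitCircle z
    z-on-circle = begin
      ∣ ofℝ c *ᶜ (w *ᶜ w) ∣²            ≡⟨ ∣∣²-* (ofℝ c) (w *ᶜ w) ⟩
      ∣ ofℝ c ∣² * ∣ w *ᶜ w ∣²           ≡⟨ cong (∣ ofℝ c ∣² *_) (∣∣²-* w w) ⟩
      ∣ ofℝ c ∣² * (∣ w ∣² * ∣ w ∣²)     ≡⟨ solve 2 (λ c N → (c :* c :+ con (+ 0) :* con (+ 0)) :* (N :* N)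
                                                            := (N :* c) :* (N :* c)) refl c ∣ w ∣² ⟩
      (∣ w ∣² * c) * (∣ w ∣² * c)        ≡⟨ cong₂ _*_ (proj₂ (∣1+it∣²-inverse t)) (proj₂ (∣1+it∣²-inverse t)) ⟩
      1r * 1r                            ≡⟨ *-identityˡ 1r ⟩
      1r                                 ∎
      where open ≡-Reasoning

    im-z^ : ∀ k → im (z ^ k) ≡ c ^ℝ k * (t * B (k ℕ.+ k) t)
    im-z^ k = begin
      im ((ofℝ c *ᶜ (w *ᶜ w)) ^ k)       ≡⟨ cong im (^-distrib-* (ofℝ c) (w *ᶜ w) k) ⟩
      im (ofℝ c ^ k *ᶜ (w *ᶜ w) ^ k)      ≡⟨ cong (λ u → im (u *ᶜ (w *ᶜ w) ^ k)) (ofℝ-^ c k) ⟩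
      im (ofℝ (c ^ℝ k) *ᶜ (w *ᶜ w) ^ k)   ≡⟨ im-ofℝ-* (c ^ℝ k) ((w *ᶜ w) ^ k) ⟩
      c ^ℝ k * im ((w *ᶜ w) ^ k)          ≡⟨ cong (λ u → c ^ℝ k * im u) (trans (^-distrib-* w w k) (sym (^-homo-* w k k))) ⟩
      c ^ℝ k * im (w ^ (k ℕ.+ k))         ≡⟨ cong (λ u → c ^ℝ k * im u) (1+it^m t (k ℕ.+ k)) ⟩
      c ^ℝ k * (t * B (k ℕ.+ k) t)        ∎
      where open ≡-Reasoning

  real-unit : ∀ {w} → OnUnitCircle w → im w ≡ 0r → w ≡ 1ᶜ ⊎ w ≡ -ᶜ 1ᶜ
  real-unit {a , b} ∣w∣≡1 b≡0 = conclude (zero-product (begin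
    (a - 1r) * (a + 1r)           ≡⟨ solve 2 (λ a b → (a :- con (+ 1)) :* (a :+ con (+ 1)) := (a :* a :+ b :* b) :- con (+ 1) :- b :* b) refl a b ⟩
    (a * a + b * b) - 1r - b * b  ≡⟨ cong₂ (λ N b → N - 1r - b * b) ∣w∣≡1 b≡0 ⟩
    1r - 1r - 0r * 0r             ≡⟨ solve 0 (con (+ 1) :- con (+ 1) :- con (+ 0) :* con (+ 0) := con (+ 0)) refl ⟩
    0r                            ∎))
    where
    open ≡-Reasoning
    conclude : a - 1r ≡ 0r ⊎ a + 1r ≡ 0r → (a , b) ≡ 1ᶜ ⊎ (a , b) ≡ -ᶜ 1ᶜ
    conclude (inj₁ a-1≡0) = inj₁ (ℂ-ext (x-y≡0⇒x≡y a-1≡0) b≡0)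
    conclude (inj₂ a+1≡0) = inj₂ (ℂ-ext (x-y≡0⇒x≡y (trans (solve 1 (λ a → a :- (:- con (+ 1)) := a :+ con (+ 1)) refl a) a+1≡0))
                                        (trans b≡0 (sym -0#≈0#)))

  open UnitCircleGeometry R using (*ᶜ-cancelˡ)
  open RegularDrawing R using (PrimitiveRootOfUnity)

  *ᶜ-neg-1 : ∀ z → z *ᶜ -ᶜ 1ᶜ ≡ -ᶜ z
  *ᶜ-neg-1 (a , b) = ℂ-ext (solve 2 (λ a b → a :* (:- con (+ 1)) :- b :* (:- con (+ 0)) := :- a) refl a b)
                           (solve 2 (λ a b → a :* (:- con (+ 0)) :+ b :* (:- con (+ 1)) := :- b) refl a b)

  -- If z^k = 1 then z^(k-1) = conj z, and if z^k = -1 with k < n then z^(k+1) = -z;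
  -- both lie strictly below the real axis.
  first-real-power : ∀ {z n k} → OnUnitCircle z → 0r < im z → (∀ j → j ℕ.≤ n → 0r ≤ im (z ^ j)) →
                     1 ℕ.≤ k → k ℕ.≤ n → im (z ^ k) ≡ 0r → k ≡ n × z ^ n ≡ -ᶜ 1ᶜ
  first-real-power {z} {n} {suc k} ∣z∣≡1 0<im-z upper-half _ k<n im≡0 = conclude (real-unit (OnUnitCircle-^ ∣z∣≡1 (suc k)) im≡0)
    where
    below-axis : ∀ {j} → j ℕ.≤ n → im (z ^ j) ≡ - im z → ⊥
    below-axis j≤n im≡-im-z = ≤⇒≯ (upper-half _ j≤n) (subst (_< 0r) (sym im≡-im-z) (0<x⇒-x<0 0<im-z))
    conclude : z ^ suc k ≡ 1ᶜ ⊎ z ^ suc k ≡ -ᶜ 1ᶜ → suc k ≡ n × z ^ n ≡ -ᶜ 1ᶜ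
    conclude (inj₁ z^k+1≡1) = ⊥-elim (below-axis (ℕ.≤-trans (ℕ.n≤1+n k) k<n)
      (cong im (*ᶜ-cancelˡ ∣z∣≡1 (trans z^k+1≡1 (sym (OnUnitCircle⇒*ᶜ-conj ∣z∣≡1))))))
    conclude (inj₂ z^k+1≡-1) with ℕ.m≤n⇒m<n∨m≡n k<n
    ... | inj₁ k+1<n = ⊥-elim (below-axis k+1<n (cong im (trans (cong (z *ᶜ_) z^k+1≡-1) (*ᶜ-neg-1 z))))
    ... | inj₂ refl  = refl , z^k+1≡-1

  0<im⇒≢1ᶜ : ∀ {w} → 0r < im w → w ≢ 1ᶜ
  0<im⇒≢1ᶜ 0<im-w refl = <-irrefl 0<im-w

  -1ᶜ≢1ᶜ : -ᶜ 1ᶜ ≢ 1ᶜ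
  -1ᶜ≢1ᶜ -1≡1 = <⇒≢ (+-pos 0<1 0<1) (sym (trans (cong (λ x → 1r + x) (sym (cong re -1≡1))) (-‿inverseʳ 1r)))

  half-turn⇒primitive : ∀ {z n} → OnUnitCircle z → z ^ n ≡ -ᶜ 1ᶜ → (∀ j → 1 ℕ.≤ j → j ℕ.< n → 0r < im (z ^ j)) →
                        PrimitiveRootOfUnity (n ℕ.* 2)
  half-turn⇒primitive {z} {n} ∣z∣≡1 z^n≡-1 upper = record
    { ζ = z ; on-circle = ∣z∣≡1 ; ζ^m≡1 = full-turn ; ζ^d≢1 = not-one }
    where
    open ≡-Reasoning
    full-turn : z ^ (n ℕ.* 2) ≡ 1ᶜ
    full-turn = begin
      z ^ (n ℕ.* 2)              ≡⟨ ^-assocʳ z n 2 ⟨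
      (z ^ n) ^ 2                ≡⟨ cong (_^ 2) z^n≡-1 ⟩
      -ᶜ 1ᶜ *ᶜ (-ᶜ 1ᶜ *ᶜ 1ᶜ)      ≡⟨ cong (-ᶜ 1ᶜ *ᶜ_) (*ᶜ-identityʳ (-ᶜ 1ᶜ)) ⟩
      -ᶜ 1ᶜ *ᶜ -ᶜ 1ᶜ              ≡⟨ *ᶜ-neg-1 (-ᶜ 1ᶜ) ⟩
      -ᶜ -ᶜ 1ᶜ                    ≡⟨ ℂ-ext (-‿involutive 1r) (-‿involutive 0r) ⟩
      1ᶜ                         ∎
    not-one : ∀ d → 0 ℕ.< d → d ℕ.< n ℕ.* 2 → z ^ d ≢ 1ᶜ
    not-one d 0<d d<2n with ℕ.<-cmp d n
    ... | tri< d<n _ _ = 0<im⇒≢1ᶜ (upper d 0<d d<n)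
    ... | tri≈ _ refl _ = -1ᶜ≢1ᶜ ∘ trans (sym z^n≡-1)
    ... | tri> _ _ n<d = λ z^d≡1 → <⇒≢ (0<x⇒-x<0 (upper e 0<e e<n)) (trans (sym (cong im z^d≡-z^e)) (cong im z^d≡1))
      where
      e : ℕ
      e = d ℕ.∸ n
      n+e≡d : n ℕ.+ e ≡ d
      n+e≡d = ℕ.m+[n∸m]≡n (ℕ.<⇒≤ n<d)
      0<e : 0 ℕ.< e
      0<e = ℕ.m<n⇒0<n∸m n<d
      e<n : e ℕ.< n
      e<n = ℕ.+-cancelˡ-< n e n (subst₂ ℕ._<_ (sym n+e≡d) (n*2≡n+n n) d<2n)
        where
        n*2≡n+n : ∀ n → n ℕ.* 2 ≡ n ℕ.+ n
        n*2≡n+n = solve-∀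
      z^d≡-z^e : z ^ d ≡ -ᶜ (z ^ e)
      z^d≡-z^e = begin
        z ^ d                  ≡⟨ cong (z ^_) n+e≡d ⟨
        z ^ (n ℕ.+ e)          ≡⟨ ^-homo-* z n e ⟩
        z ^ n *ᶜ z ^ e         ≡⟨ cong (_*ᶜ z ^ e) z^n≡-1 ⟩
        -ᶜ 1ᶜ *ᶜ z ^ e         ≡⟨ *ᶜ-comm (-ᶜ 1ᶜ) (z ^ e) ⟩
        z ^ e *ᶜ -ᶜ 1ᶜ         ≡⟨ *ᶜ-neg-1 (z ^ e) ⟩
        -ᶜ (z ^ e)             ∎

  B-even : ∀ {n} → Fin n → ℝ → ℝ
  B-even i = B (suc (toℕ i) ℕ.+ suc (toℕ i))

  -- For n ≥ 2, t is the first zero of one of B 2, B 4, …, B (2 n); one exists in (0, 1] since B 4 1 = 0.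
  primitiveRoot : ∀ n → 1 ℕ.≤ n → PrimitiveRootOfUnity (n ℕ.* 2)
  primitiveRoot 1 _ = half-turn⇒primitive {n = 1} (OnUnitCircle-neg OnUnitCircle-1ᶜ) (*ᶜ-identityʳ (-ᶜ 1ᶜ)) λ { (suc _) _ (s≤s ()) }
  primitiveRoot n@(suc (suc _)) _ =
    from-first-zero (first-zero B-even (λ i → proj₂ (tame-AB (suc (toℕ i) ℕ.+ suc (toℕ i))))
                                       (λ i → B-suc-at-0-pos (toℕ i ℕ.+ suc (toℕ i)))
                                       (Fin.suc Fin.zero , inj₂ B-4-at-1))
    where
    from-first-zero : (∃ λ t → 0r < t × t ≤ 1r × (∀ i → 0r ≤ B-even i t) × (∃ λ i → B-even {n} i t ≡ 0r)) →
                      PrimitiveRootOfUnity (n ℕ.* 2)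
    from-first-zero (t , 0<t , _ , nonNeg , i₀ , B[i₀]≡0) = half-turn⇒primitive z-on-circle z^n≡-1 upper
      where
      open NormalisedSquare t
      0<im-z : 0r < im z
      0<im-z = subst (0r <_) (sym (trans (cong im (sym (*ᶜ-identityʳ z))) (im-z^ 1)))
                     (*-pos (^ℝ-pos 0<c 1) (*-pos 0<t (subst (0r <_) (sym (B-2 t)) (+-pos 0<1 0<1))))
      upper-half : ∀ j → j ℕ.≤ n → 0r ≤ im (z ^ j)
      upper-half zero    _   = inj₂ refl
      upper-half (suc j) j<n = subst (0r ≤_) (sym (im-z^ (suc j)))
        (*-nonNeg (inj₁ (^ℝ-pos 0<c (suc j))) (*-nonNeg (inj₁ 0<t)
          (subst (λ k → 0r ≤ B (suc k ℕ.+ suc k) t) (Fin.toℕ-fromℕ< j<n) (nonNeg (Fin.fromℕ< j<n)))))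
      first-real : ∀ {k} → 1 ℕ.≤ k → k ℕ.≤ n → im (z ^ k) ≡ 0r → k ≡ n × z ^ n ≡ -ᶜ 1ᶜ
      first-real = first-real-power z-on-circle 0<im-z upper-half
      z^n≡-1 : z ^ n ≡ -ᶜ 1ᶜ
      z^n≡-1 = proj₂ (first-real (s≤s z≤n) (Fin.toℕ<n i₀)
        (trans (im-z^ (suc (toℕ i₀))) (trans (cong (λ b → c ^ℝ suc (toℕ i₀) * (t * b)) B[i₀]≡0)
                                            (trans (cong (c ^ℝ suc (toℕ i₀) *_) (zeroʳ t)) (zeroʳ _)))))
      upper : ∀ j → 1 ℕ.≤ j → j ℕ.< n → 0r < im (z ^ j)
      upper j 1≤j j<n = ≤∧≢⇒< (upper-half j (ℕ.<⇒≤ j<n)) λ 0≡im → ℕ.<⇒≢ j<n (proj₁ (first-real 1≤j (ℕ.<⇒≤ j<n) (sym 0≡im)))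

open import Data.Nat using (_≤_)

proposition2 : (R : RealField) → (n : ℕ) → 1 ≤ n →
    Plane.SlopeNumberIs R (KBip n n) n × Plane.ConvexSlopeNumberIs R (KBip n n) n
proposition2 R n@(suc _) 1≤n =
  ((regularDrawing , regularDrawing-slopes) , Kₙₙ-atLeastSlopes) ,
  ((regularDrawing , regularDrawing-convex , regularDrawing-slopes) , λ D _ → Kₙₙ-atLeastSlopes D)
  where
  open RegularDrawing.Kₙₙ R {n} (RootConstruction.primitiveRoot R n 1≤n)
  open LowerBound R
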